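{- Let $n\ge1$ and $k\geq 1$ be integers. Then \[\sum_{[\mathbf m,\mathbf a,\mathbf b]}\frac{t^{|\mathbf m|}\,q^{\mathrm{dinv}_k(\mathbf m,\mathbf a,\mathbf b)}}{(1-q)^n\,\mathrm{aut}_q(\mathbf m,\mathbf a,\mathbf b)}\,X_{\mathbf a}Y_{\mathbf b} =\sum_{[\mathbf m,\mathbf a]}\frac{t^{|\mathbf m|}\,q^{\mathrm{dinv}_k(\mathbf m,\mathbf a)}}{(1-q)^n\,\mathrm{aut}_q(\mathbf m,\mathbf a)}\,X_{\mathbf a}\,\xi_{D_k(\mathbf m,\mathbf a)}[Y;q].\]
   Context: $X=(x_1,x_2,\dots)$, $Y=(y_1,y_2,\dots)$ are alphabets; a label is an $n$-tuple of positive integers; $X_{\mathbf a}=x_{a_1}\cdots x_{a_n}$, $Y_{\mathbf b}=y_{b_1}\cdots y_{b_n}$, $|\mathbf m|=\sum m_i$, $\delta(P)\in\{0,1\}$ is the indicator of $P$, $[r]_q!=\prod_{j=1}^r(1+q+\dots+q^{j-1})$. A triple $(\mathbf m,\mathbf a,\mathbf b)$ with $\mathbf m\in\mathbb Z_{\ge0}^n$ and labels $\mathbf a,\mathbf b$ is sorted if for all $i<j$: $m_i\ge m_j$; if $m_i=m_j$ then $a_i\le a_j$; if moreover $a_i=a_j$ then $b_i\le b_j$. A pair $(\mathbf m,\mathbf a)$ is sorted if the first two conditions hold. $\sum_{[\mathbf m,\mathbf a,\mathbf b]}$ (resp. $\sum_{[\mathbf m,\mathbf a]}$) is the sum over orbits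 of the simultaneous $S_n$-action on coordinates, the summand being evaluated at the unique sorted representative. For sorted $(\mathbf m,\mathbf a,\mathbf b)$: $\mathrm{dinv}_k(\mathbf m,\mathbf a,\mathbf b)=\sum_{i<j}\max(m_j-m_i-1+k+\delta(a_i>a_j)+\delta(b_i>b_j),0)$, and $\mathrm{dinv}_k(\mathbf m,\mathbf a)=\mathrm{dinv}_k(\mathbf m,\mathbf a,(1,\dots,1))$. $\mathrm{aut}_q(\mathbf m,\mathbf a,\mathbf b)=\prod_s[\mu_s]_q!$ with $\mu_s$ the multiplicities of the distinct triples $(m_i,a_i,b_i)$; $\mathrm{aut}_q(\mathbf m,\mathbf a)$ likewise with the distinct pairs $(m_i,a_i)$. For sorted $(\mathbf m,\mathbf a)$, $D_k(\mathbf m,\mathbf a)=\{(i,j):1\le i<j\le n,\ m_j-m_i-1+k+\delta(a_i>a_j)\ge 0\}$ (the pairs where $i$ $k$-attacks $j$). For a set $D$ of pairs $i<j$, $\xi_D[Y;q]=\sum_{\mathbf b}q^{\#\{(i,j)\in D:\,b_i>b_j\}}Y_{\mathbf b}$, the sum over all labels $\mathbf b$ (no sorting). -}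

module Defs where

open import Data.Bool using (Bool; true; false; _∧_; if_then_else_)
open import Data.Nat using (ℕ; zero; suc; _+_; _∸_; _⊔_; _≡ᵇ_; _<ᵇ_; _≤ᵇ_)
open import Data.Integer as ℤ using (ℤ; +_; -[1+_])
open import Data.List using (List; []; _∷_; _++_; map; foldr; concatMap;  length; replicate; upTo; zip; zipWith; filterᵇ)
open import Data.Bool.ListAction using (and; all)
open import Data.Nat.ListAction using (sum)
open import Data.Product using (_×_; _,_; proj₁; proj₂)
open import Relation.Binary.PropositionalEquality using (_≡_)

-- Polynomials in q with integer coefficients (coefficient lists,
-- lowest degree first), and rational functions in q as fractions.

Poly : Set
Poly = List ℤ

_⊕_ : Poly → Poly → Poly
[]      ⊕ p       = p
(a ∷ p) ⊕ []      = a ∷ p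
(a ∷ p) ⊕ (b ∷ r) = (a ℤ.+ b) ∷ (p ⊕ r)

scale : ℤ → Poly → Poly
scale c = map (c ℤ.*_)

_⊗_ : Poly → Poly → Poly
[]      ⊗ r = []
(a ∷ p) ⊗ r = scale a r ⊕ (+ 0 ∷ (p ⊗ r))

coeff : Poly → ℕ → ℤ
coeff []      _       = + 0
coeff (a ∷ p) zero    = a
coeff (a ∷ p) (suc i) = coeff p i

_≈P_ : Poly → Poly → Set
p ≈P r = ∀ i → coeff p i ≡ coeff r i

qpow : ℕ → Poly
qpow d = replicate d (+ 0) ++ (+ 1 ∷ [])

qint : ℕ → Poly
qint r = replicate r (+ 1)

qfact : ℕ → Poly
qfact zero    = + 1 ∷ []
qfact (suc r) = qfact r ⊗ qint (suc r)

polyPow : Poly → ℕ → Poly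
polyPow p zero    = + 1 ∷ []
polyPow p (suc e) = polyPow p e ⊗ p

oneMinusQ : Poly
oneMinusQ = + 1 ∷ -[1+ 0 ] ∷ []

-- Rational functions in q: numerator / denominator.  All denominators
-- occurring below are products of (1-q)^n and q-factorials, hence nonzero.
record RatQ : Set where
  constructor _/_
  field
    num : Poly
    den : Poly
open RatQ public

_≃_ : RatQ → RatQ → Set
(a / b) ≃ (c / d) = (a ⊗ d) ≈P (c ⊗ b)

zeroR : RatQ
zeroR = [] / (+ 1 ∷ [])

_⊞_ : RatQ → RatQ → RatQ
(a / b) ⊞ (c / d) = ((a ⊗ d) ⊕ (c ⊗ b)) / (b ⊗ d)

sumR : List RatQ → RatQ
sumR = foldr _⊞_ zeroR

tuples : ℕ → List ℕ → List (List ℕ)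
tuples zero    vs = [] ∷ []
tuples (suc n) vs = concatMap (λ v → map (v ∷_) (tuples n vs)) vs

pairs : {A : Set} → List A → List (A × A)
pairs []       = []
pairs (x ∷ xs) = map (x ,_) xs ++ pairs xs

countᵇ : {A : Set} → (A → Bool) → List A → ℕ
countᵇ p xs = length (filterᵇ p xs)

δ : Bool → ℕ
δ true  = 1
δ false = 0

_>ᵇ_ : ℕ → ℕ → Bool
x >ᵇ y = y <ᵇ x

maxL : List ℕ → ℕ
maxL = foldr _⊔_ 0

-- same multiset of entries (X_a = X_α as commutative monomials)
sameContent : List ℕ → List ℕ → Bool
sameContent xs ys =
  (length xs ≡ᵇ length ys) ∧
  all (λ v → countᵇ (v ≡ᵇ_) xs ≡ᵇ countᵇ (v ≡ᵇ_) ys) (xs ++ ys)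

Triple : Set
Triple = ℕ × ℕ × ℕ

zip3 : List ℕ → List ℕ → List ℕ → List Triple
zip3 ms as bs = zip ms (zip as bs)

_==T_ : Triple → Triple → Bool
(m , a , b) ==T (m' , a' , b') = (m ≡ᵇ m') ∧ (a ≡ᵇ a') ∧ (b ≡ᵇ b')

_==P_ : ℕ × ℕ → ℕ × ℕ → Bool
(m , a) ==P (m' , a') = (m ≡ᵇ m') ∧ (a ≡ᵇ a')

distinct : {A : Set} → (A → A → Bool) → List A → List A
distinct eq []       = []
distinct eq (x ∷ xs) = x ∷ filterᵇ (λ y → if eq x y then false else true) (distinct eq xs)

sortedPairT : Triple × Triple → Bool
sortedPairT ((mi , ai , bi) , (mj , aj , bj)) =
  (mj ≤ᵇ mi) ∧
  (if mi ≡ᵇ mj then ((ai ≤ᵇ aj) ∧ (if ai ≡ᵇ aj then bi ≤ᵇ bj else true)) else true)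

sorted3 : List ℕ → List ℕ → List ℕ → Bool
sorted3 ms as bs = and (map sortedPairT (pairs (zip3 ms as bs)))

sortedPairP : (ℕ × ℕ) × (ℕ × ℕ) → Bool
sortedPairP ((mi , ai) , (mj , aj)) =
  (mj ≤ᵇ mi) ∧ (if mi ≡ᵇ mj then ai ≤ᵇ aj else true)

sorted2 : List ℕ → List ℕ → Bool
sorted2 ms as = and (map sortedPairP (pairs (zip ms as)))

-- max(m_j - m_i - 1 + k + δ(a_i>a_j) + δ(b_i>b_j), 0)
dinvTerm : ℕ → Triple × Triple → ℕ
dinvTerm k ((mi , ai , bi) , (mj , aj , bj)) =
  (mj + k + δ (ai >ᵇ aj) + δ (bi >ᵇ bj)) ∸ (mi + 1)

dinv3 : ℕ → List ℕ → List ℕ → List ℕ → ℕ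
dinv3 k ms as bs = sum (map (dinvTerm k) (pairs (zip3 ms as bs)))

dinv2 : ℕ → List ℕ → List ℕ → ℕ
dinv2 k ms as = dinv3 k ms as (replicate (length ms) 1)

aut3 : List ℕ → List ℕ → List ℕ → Poly
aut3 ms as bs =
  let ts = zip3 ms as bs in
  foldr _⊗_ (+ 1 ∷ [])
    (map (λ t → qfact (countᵇ (t ==T_) ts)) (distinct _==T_ ts))

aut2 : List ℕ → List ℕ → Poly
aut2 ms as =
  let ps = zip ms as in
  foldr _⊗_ (+ 1 ∷ [])
    (map (λ p → qfact (countᵇ (p ==P_) ps)) (distinct _==P_ ps))

attacks : ℕ → (ℕ × ℕ) × (ℕ × ℕ) → Bool
attacks k ((mi , ai) , (mj , aj)) = (mi + 1) ≤ᵇ (mj + k + δ (ai >ᵇ aj))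

invD : ℕ → List ℕ → List ℕ → List ℕ → ℕ
invD k ms as bs =
  countᵇ (λ { ((mi , ai , bi) , (mj , aj , bj)) →
              attacks k ((mi , ai) , (mj , aj)) ∧ (bi >ᵇ bj) })
         (pairs (zip3 ms as bs))

-- coefficient of the monomial Y_β in ξ_{D_k(m,a)}[Y;q]:
-- sum over all labels b (unsorted) with Y_b = Y_β
xiCoeff : ℕ → List ℕ → List ℕ → List ℕ → Poly
xiCoeff k ms as β =
  foldr _⊕_ []
    (map (λ bs → qpow (invD k ms as bs))
         (filterᵇ (λ bs → sameContent bs β) (tuples (length β) (upTo (suc (maxL β))))))

-- Coefficient of t^N X_α Y_β on both sides

-- LHS: sum over sorted triples (= orbit representatives) with |m| = N,
-- X_a = X_α, Y_b = Y_β, of q^dinv / ((1-q)^n aut_q)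
lhsCoeff : ℕ → ℕ → ℕ → List ℕ → List ℕ → RatQ
lhsCoeff n k N α β =
  sumR (concatMap (λ ms → concatMap (λ as →
         map (λ bs → qpow (dinv3 k ms as bs) / (polyPow oneMinusQ n ⊗ aut3 ms as bs))
             (filterᵇ (λ bs → sameContent bs β ∧ sorted3 ms as bs)
                         (tuples n (upTo (suc (maxL β))))))
         (filterᵇ (λ as → sameContent as α) (tuples n (upTo (suc (maxL α))))))
       (filterᵇ (λ ms → sum ms ≡ᵇ N) (tuples n (upTo (suc N)))))

rhsCoeff : ℕ → ℕ → ℕ → List ℕ → List ℕ → RatQ
rhsCoeff n k N α β =
  sumR (concatMap (λ ms →
         map (λ as → (qpow (dinv2 k ms as) ⊗ xiCoeff k ms as β)
                     / (polyPow oneMinusQ n ⊗ aut2 ms as))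
             (filterᵇ (λ as → sameContent as α ∧ sorted2 ms as)
                         (tuples n (upTo (suc (maxL α))))))
       (filterᵇ (λ ms → sum ms ≡ᵇ N) (tuples n (upTo (suc N)))))

-- For a fixed (m, a), adding a label inversion to a pair i < j changes
-- max(m_j - m_i - 1 + k + δ(a_i > a_j), 0) by one exactly when i k-attacks j, so
-- dinv_k(m, a, b) = dinv_k(m, a) + #{(i, j) ∈ D_k(m, a) : b_i > b_j}.
-- Group the positions into the blocks of equal (m_i, a_i) of the sorted pair (m, a) and
-- group the labellings b with content β by the labelling obtained by sorting b inside each
-- block. Inside a block every earlier position attacks every later one (k ≥ 1), so a block
-- contributes the inversion generating function of its labels, which is
-- [size]_q! / Π [multiplicity]_q! by the q-multinomial theorem, while the attacks between
-- different blocks only depend on the multisets of labels. Hence the Y_β-coefficient of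
-- q^{dinv_k(m,a)} ξ_{D_k(m,a)}[Y;q] / aut_q(m, a) is the sum of q^{dinv_k(m,a,b)} / aut_q(m,a,b)
-- over the blockwise sorted b with content β, and these are exactly the b making (m, a, b) sorted.
-- Rational functions are compared by cross-multiplication; all denominators have constant
-- term 1 and can be cancelled.

module Submission where

open import Algebra.Bundles using (CommutativeSemiring)
import Algebra.Properties.CommutativeSemigroup as CommSemigroupProperties
open import Data.Bool using (Bool; true; false; _∧_; if_then_else_; T; T?)
open import Data.Bool.ListAction using (and; all)
open import Data.Bool.Properties using (∧-zeroʳ; ∧-identityʳ)
open import Data.Empty using (⊥-elim)
open import Data.Integer as ℤ using (ℤ; 0ℤ; 1ℤ; -1ℤ)
import Data.Integer.Properties as ℤ
open import Data.List
  using (List; []; _∷_; _++_; map; foldr; concatMap; length; replicate; filterᵇ; zip; take; drop; upTo)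
import Data.List.Properties as List
open import Data.List.Relation.Binary.Permutation.Propositional using (_↭_; ↭-refl; ↭-sym)
import Data.List.Relation.Binary.Permutation.Propositional.Properties as Perm
open import Data.List.Relation.Unary.All as All using (All; []; _∷_)
import Data.List.Relation.Unary.All.Properties as All
open import Data.List.Relation.Unary.AllPairs as AllPairs using (AllPairs; []; _∷_)
import Data.List.Relation.Unary.AllPairs.Properties as AllPairs
open import Data.List.Relation.Unary.Linked.Properties using (Linked⇒AllPairs)
open import Data.Maybe using (nothing)
open import Data.Nat using (ℕ; zero; suc; _+_; _*_; _⊓_; _∸_; _≤_; _<_; _≡ᵇ_; _<ᵇ_; _≤ᵇ_)
import Data.Nat.Properties as ℕ
open import Data.Nat.ListAction using (sum)
open import Data.Nat.ListAction.Properties using (sum-↭; sum-++)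
open import Data.Nat.Tactic.RingSolver using () renaming (solve-∀ to ℕ-solve-∀)
open import Data.List.Sort.InsertionSort.Base ℕ.≤-decTotalOrder using (insert; sort)
import Data.List.Sort.InsertionSort.Properties ℕ.≤-decTotalOrder as Sort
open import Data.Product using (_×_; _,_; proj₁; proj₂)
open import Function using (_∘_)
open import Relation.Binary.Bundles using (Setoid)
open import Relation.Binary.PropositionalEquality
import Relation.Binary.Reasoning.Setoid
open import Relation.Binary.Structures using (IsEquivalence)
open import Relation.Nullary using (¬_)
open import Tactic.RingSolver using (solve-∀)
open import Tactic.RingSolver.Core.AlmostCommutativeRing using (AlmostCommutativeRing; fromCommutativeSemiring)

open import Defs

private
  module ℤ+ = CommSemigroupProperties ℤ.+-commutativeSemigroup
  module ℕ+ = CommSemigroupProperties ℕ.+-commutativeSemigroup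

-- Polynomials

-- A record, so that both sides of an equation can be inferred from its type.
infix 4 _≈_
record _≈_ (p r : Poly) : Set where
  constructor mk≈
  field coeff-≡ : p ≈P r
open _≈_ public

≈-refl : ∀ {p} → p ≈ p
≈-refl = mk≈ λ _ → refl

≈-sym : ∀ {p r} → p ≈ r → r ≈ p
≈-sym e = mk≈ λ i → sym (coeff-≡ e i)

≈-trans : ∀ {p r s} → p ≈ r → r ≈ s → p ≈ s
≈-trans e f = mk≈ λ i → trans (coeff-≡ e i) (coeff-≡ f i)

≡⇒≈ : ∀ {p r} → p ≡ r → p ≈ r
≡⇒≈ refl = ≈-refl

≈-isEquivalence : IsEquivalence _≈_
≈-isEquivalence = record { refl = ≈-refl ; sym = ≈-sym ; trans = ≈-trans }

coeff-⊕ : ∀ p r i → coeff (p ⊕ r) i ≡ coeff p i ℤ.+ coeff r i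
coeff-⊕ []      r       i       = sym (ℤ.+-identityˡ _)
coeff-⊕ (a ∷ p) []      zero    = sym (ℤ.+-identityʳ _)
coeff-⊕ (a ∷ p) []      (suc i) = sym (ℤ.+-identityʳ _)
coeff-⊕ (a ∷ p) (b ∷ r) zero    = refl
coeff-⊕ (a ∷ p) (b ∷ r) (suc i) = coeff-⊕ p r i

coeff-scale : ∀ c p i → coeff (scale c p) i ≡ c ℤ.* coeff p i
coeff-scale c []      i       = sym (ℤ.*-zeroʳ c)
coeff-scale c (a ∷ p) zero    = refl
coeff-scale c (a ∷ p) (suc i) = coeff-scale c p i

∷-cong : ∀ {a b p r} → a ≡ b → p ≈ r → (a ∷ p) ≈ (b ∷ r)
∷-cong a≡b p≈r = mk≈ λ { zero → a≡b ; (suc i) → coeff-≡ p≈r i }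

shift-cong : ∀ {p r} → p ≈ r → (0ℤ ∷ p) ≈ (0ℤ ∷ r)
shift-cong = ∷-cong refl

shift-[] : (0ℤ ∷ []) ≈ []
shift-[] = mk≈ λ { zero → refl ; (suc i) → refl }

⊕-cong : ∀ {p p′ r r′} → p ≈ p′ → r ≈ r′ → (p ⊕ r) ≈ (p′ ⊕ r′)
⊕-cong {p} {p′} {r} {r′} e f = mk≈ λ i → begin
  coeff (p ⊕ r) i           ≡⟨ coeff-⊕ p r i ⟩
  coeff p i ℤ.+ coeff r i   ≡⟨ cong₂ ℤ._+_ (coeff-≡ e i) (coeff-≡ f i) ⟩
  coeff p′ i ℤ.+ coeff r′ i ≡⟨ coeff-⊕ p′ r′ i ⟨
  coeff (p′ ⊕ r′) i         ∎
  where open ≡-Reasoning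

⊕-comm : ∀ p r → (p ⊕ r) ≈ (r ⊕ p)
⊕-comm p r = mk≈ λ i → trans (coeff-⊕ p r i) (trans (ℤ.+-comm (coeff p i) _) (sym (coeff-⊕ r p i)))

⊕-assoc : ∀ p r s → ((p ⊕ r) ⊕ s) ≈ (p ⊕ (r ⊕ s))
⊕-assoc p r s = mk≈ λ i → begin
  coeff ((p ⊕ r) ⊕ s) i                   ≡⟨ coeff-⊕ (p ⊕ r) s i ⟩
  coeff (p ⊕ r) i ℤ.+ coeff s i           ≡⟨ cong (ℤ._+ coeff s i) (coeff-⊕ p r i) ⟩
  (coeff p i ℤ.+ coeff r i) ℤ.+ coeff s i ≡⟨ ℤ.+-assoc (coeff p i) _ _ ⟩
  coeff p i ℤ.+ (coeff r i ℤ.+ coeff s i) ≡⟨ cong (λ z → coeff p i ℤ.+ z) (coeff-⊕ r s i) ⟨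
  coeff p i ℤ.+ coeff (r ⊕ s) i           ≡⟨ coeff-⊕ p (r ⊕ s) i ⟨
  coeff (p ⊕ (r ⊕ s)) i                   ∎
  where open ≡-Reasoning

⊕-identityʳ : ∀ p → (p ⊕ []) ≈ p
⊕-identityʳ []      = ≈-refl
⊕-identityʳ (a ∷ p) = ≈-refl

scale-cong : ∀ c {p r} → p ≈ r → scale c p ≈ scale c r
scale-cong c {p} {r} e = mk≈ λ i →
  trans (coeff-scale c p i) (trans (cong (c ℤ.*_) (coeff-≡ e i)) (sym (coeff-scale c r i)))

scale-distribˡ : ∀ c p r → scale c (p ⊕ r) ≈ (scale c p ⊕ scale c r)
scale-distribˡ c p r = mk≈ λ i → begin
  coeff (scale c (p ⊕ r)) i                   ≡⟨ coeff-scale c (p ⊕ r) i ⟩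
  c ℤ.* coeff (p ⊕ r) i                       ≡⟨ cong (c ℤ.*_) (coeff-⊕ p r i) ⟩
  c ℤ.* (coeff p i ℤ.+ coeff r i)             ≡⟨ ℤ.*-distribˡ-+ c (coeff p i) _ ⟩
  c ℤ.* coeff p i ℤ.+ c ℤ.* coeff r i         ≡⟨ cong₂ ℤ._+_ (coeff-scale c p i) (coeff-scale c r i) ⟨
  coeff (scale c p) i ℤ.+ coeff (scale c r) i ≡⟨ coeff-⊕ (scale c p) (scale c r) i ⟨
  coeff (scale c p ⊕ scale c r) i             ∎
  where open ≡-Reasoning

scale-distribʳ : ∀ a b p → scale (a ℤ.+ b) p ≈ (scale a p ⊕ scale b p)
scale-distribʳ a b p = mk≈ λ i → begin
  coeff (scale (a ℤ.+ b) p) i                 ≡⟨ coeff-scale (a ℤ.+ b) p i ⟩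
  (a ℤ.+ b) ℤ.* coeff p i                     ≡⟨ ℤ.*-distribʳ-+ (coeff p i) a b ⟩
  a ℤ.* coeff p i ℤ.+ b ℤ.* coeff p i         ≡⟨ cong₂ ℤ._+_ (coeff-scale a p i) (coeff-scale b p i) ⟨
  coeff (scale a p) i ℤ.+ coeff (scale b p) i ≡⟨ coeff-⊕ (scale a p) (scale b p) i ⟨
  coeff (scale a p ⊕ scale b p) i             ∎
  where open ≡-Reasoning

scale-assoc : ∀ a b p → scale (a ℤ.* b) p ≈ scale a (scale b p)
scale-assoc a b p = mk≈ λ i → begin
  coeff (scale (a ℤ.* b) p) i   ≡⟨ coeff-scale (a ℤ.* b) p i ⟩
  a ℤ.* b ℤ.* coeff p i         ≡⟨ ℤ.*-assoc a b _ ⟩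
  a ℤ.* (b ℤ.* coeff p i)       ≡⟨ cong (a ℤ.*_) (coeff-scale b p i) ⟨
  a ℤ.* coeff (scale b p) i     ≡⟨ coeff-scale a (scale b p) i ⟨
  coeff (scale a (scale b p)) i ∎
  where open ≡-Reasoning

scale-zero : ∀ {c} p → c ≡ 0ℤ → scale c p ≈ []
scale-zero p refl = mk≈ λ i → trans (coeff-scale 0ℤ p i) (ℤ.*-zeroˡ (coeff p i))

scale-identity : ∀ p → scale 1ℤ p ≈ p
scale-identity p = mk≈ λ i → trans (coeff-scale 1ℤ p i) (ℤ.*-identityˡ (coeff p i))

⊕-rearrange : ∀ x y z w → ((x ⊕ y) ⊕ (z ⊕ w)) ≈ ((x ⊕ z) ⊕ (y ⊕ w))
⊕-rearrange x y z w = mk≈ λ i → begin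
  coeff ((x ⊕ y) ⊕ (z ⊕ w)) i
    ≡⟨ trans (coeff-⊕ (x ⊕ y) (z ⊕ w) i) (cong₂ ℤ._+_ (coeff-⊕ x y i) (coeff-⊕ z w i)) ⟩
  (coeff x i ℤ.+ coeff y i) ℤ.+ (coeff z i ℤ.+ coeff w i)
    ≡⟨ ℤ+.interchange (coeff x i) (coeff y i) (coeff z i) (coeff w i) ⟩
  (coeff x i ℤ.+ coeff z i) ℤ.+ (coeff y i ℤ.+ coeff w i)
    ≡⟨ trans (coeff-⊕ (x ⊕ z) (y ⊕ w) i) (cong₂ ℤ._+_ (coeff-⊕ x z i) (coeff-⊕ y w i)) ⟨
  coeff ((x ⊕ z) ⊕ (y ⊕ w)) i ∎
  where open ≡-Reasoning

⊕-swap : ∀ x y z → (x ⊕ (y ⊕ z)) ≈ (y ⊕ (x ⊕ z))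
⊕-swap x y z =
  ≈-trans (≈-sym (⊕-assoc x y z)) (≈-trans (⊕-cong (⊕-comm x y) ≈-refl) (⊕-assoc y x z))

⊗-zeroʳ : ∀ p → (p ⊗ []) ≈ []
⊗-zeroʳ []      = ≈-refl
⊗-zeroʳ (a ∷ p) = ≈-trans (shift-cong (⊗-zeroʳ p)) shift-[]

⊗-shiftˡ : ∀ p r → ((0ℤ ∷ p) ⊗ r) ≈ (0ℤ ∷ (p ⊗ r))
⊗-shiftˡ p r = ⊕-cong (scale-zero r refl) ≈-refl

⊗-congʳ : ∀ p {r r′} → r ≈ r′ → (p ⊗ r) ≈ (p ⊗ r′)
⊗-congʳ []      e = ≈-refl
⊗-congʳ (a ∷ p) e = ⊕-cong (scale-cong a e) (shift-cong (⊗-congʳ p e))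

⊗-consʳ : ∀ p b r → (p ⊗ (b ∷ r)) ≈ (scale b p ⊕ (0ℤ ∷ (p ⊗ r)))
⊗-consʳ []      b r = ≈-sym shift-[]
⊗-consʳ (a ∷ p) b r =
  ∷-cong (cong (ℤ._+ 0ℤ) (ℤ.*-comm a b))
    (≈-trans (⊕-cong (≈-refl {scale a r}) (⊗-consʳ p b r)) (⊕-swap (scale a r) (scale b p) _))

⊗-comm : ∀ p r → (p ⊗ r) ≈ (r ⊗ p)
⊗-comm []      r = ≈-sym (⊗-zeroʳ r)
⊗-comm (a ∷ p) r = ≈-trans (⊕-cong ≈-refl (shift-cong (⊗-comm p r))) (≈-sym (⊗-consʳ r a p))

⊗-congˡ : ∀ {p p′} r → p ≈ p′ → (p ⊗ r) ≈ (p′ ⊗ r)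
⊗-congˡ {p} {p′} r e = ≈-trans (⊗-comm p r) (≈-trans (⊗-congʳ r e) (⊗-comm r p′))

⊗-cong : ∀ {p p′ r r′} → p ≈ p′ → r ≈ r′ → (p ⊗ r) ≈ (p′ ⊗ r′)
⊗-cong {p′ = p′} {r} e f = ≈-trans (⊗-congˡ r e) (⊗-congʳ p′ f)

⊗-distribʳ : ∀ p p′ r → ((p ⊕ p′) ⊗ r) ≈ ((p ⊗ r) ⊕ (p′ ⊗ r))
⊗-distribʳ []      p′       r = ≈-refl
⊗-distribʳ (a ∷ p) []       r = ≈-sym (⊕-identityʳ _)
⊗-distribʳ (a ∷ p) (b ∷ p′) r =
  ≈-trans (⊕-cong (scale-distribʳ a b r) (shift-cong (⊗-distribʳ p p′ r)))
          (⊕-rearrange (scale a r) (scale b r) (0ℤ ∷ (p ⊗ r)) (0ℤ ∷ (p′ ⊗ r)))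

⊗-distribˡ : ∀ p r r′ → (p ⊗ (r ⊕ r′)) ≈ ((p ⊗ r) ⊕ (p ⊗ r′))
⊗-distribˡ p r r′ =
  ≈-trans (⊗-comm p (r ⊕ r′)) (≈-trans (⊗-distribʳ r r′ p) (⊕-cong (⊗-comm r p) (⊗-comm r′ p)))

scale-⊗ : ∀ c r s → (scale c r ⊗ s) ≈ scale c (r ⊗ s)
scale-⊗ c []      s = ≈-refl
scale-⊗ c (a ∷ r) s =
  ≈-trans (⊕-cong (scale-assoc c a s) (∷-cong (sym (ℤ.*-zeroʳ c)) (scale-⊗ c r s)))
          (≈-sym (scale-distribˡ c (scale a s) (0ℤ ∷ (r ⊗ s))))

⊗-assoc : ∀ p r s → ((p ⊗ r) ⊗ s) ≈ (p ⊗ (r ⊗ s))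
⊗-assoc []      r s = ≈-refl
⊗-assoc (a ∷ p) r s =
  ≈-trans (⊗-distribʳ (scale a r) (0ℤ ∷ (p ⊗ r)) s)
          (⊕-cong (scale-⊗ a r s) (≈-trans (⊗-shiftˡ (p ⊗ r) s) (shift-cong (⊗-assoc p r s))))

one : Poly
one = 1ℤ ∷ []

⊗-identityˡ : ∀ r → (one ⊗ r) ≈ r
⊗-identityˡ r = ≈-trans (⊕-cong (scale-identity r) shift-[]) (⊕-identityʳ r)

⊗-identityʳ : ∀ r → (r ⊗ one) ≈ r
⊗-identityʳ r = ≈-trans (⊗-comm r one) (⊗-identityˡ r)

Poly-commutativeSemiring : CommutativeSemiring _ _
Poly-commutativeSemiring = record
  { Carrier = Poly ; _≈_ = _≈_ ; _+_ = _⊕_ ; _*_ = _⊗_ ; 0# = [] ; 1# = one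
  ; isCommutativeSemiring = record
    { isSemiring = record
      { isSemiringWithoutAnnihilatingZero = record
        { +-isCommutativeMonoid = record
          { isMonoid = record
            { isSemigroup = record
              { isMagma = record { isEquivalence = ≈-isEquivalence ; ∙-cong = ⊕-cong }
              ; assoc = ⊕-assoc }
            ; identity = (λ _ → ≈-refl) , ⊕-identityʳ }
          ; comm = ⊕-comm }
        ; *-cong = ⊗-cong
        ; *-assoc = ⊗-assoc
        ; *-identity = ⊗-identityˡ , ⊗-identityʳ
        ; distrib = ⊗-distribˡ , (λ x y z → ⊗-distribʳ y z x) }
      ; zero = (λ _ → ≈-refl) , ⊗-zeroʳ }
    ; *-comm = ⊗-comm } }

≈-setoid : Setoid _ _
≈-setoid = CommutativeSemiring.setoid Poly-commutativeSemiring

module ≈-Reasoning = Relation.Binary.Reasoning.Setoid ≈-setoid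

Poly-ring : AlmostCommutativeRing _ _
Poly-ring = fromCommutativeSemiring Poly-commutativeSemiring (λ _ → nothing)

ConstantOne : Poly → Set
ConstantOne d = coeff d 0 ≡ 1ℤ

coeff₀-⊗ : ∀ p r → coeff (p ⊗ r) 0 ≡ coeff p 0 ℤ.* coeff r 0
coeff₀-⊗ []      r = refl
coeff₀-⊗ (a ∷ p) r =
  trans (coeff-⊕ (scale a r) (0ℤ ∷ (p ⊗ r)) 0) (trans (ℤ.+-identityʳ _) (coeff-scale a r 0))

constantOne-⊗ : ∀ {p r} → ConstantOne p → ConstantOne r → ConstantOne (p ⊗ r)
constantOne-⊗ {p} {r} cp cr = trans (coeff₀-⊗ p r) (cong₂ ℤ._*_ cp cr)

constantOne-qfact : ∀ r → ConstantOne (qfact r)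
constantOne-qfact zero    = refl
constantOne-qfact (suc r) = constantOne-⊗ {qfact r} {qint (suc r)} (constantOne-qfact r) refl

constantOne-polyPow : ∀ {p} n → ConstantOne p → ConstantOne (polyPow p n)
constantOne-polyPow zero    cp = refl
constantOne-polyPow {p} (suc n) cp = constantOne-⊗ {polyPow p n} {p} (constantOne-polyPow n cp) cp

-- Comparing constant terms in d ⊗ (c ∷ z) = c d + q (d ⊗ z) forces c = 0.
constantOne-noZeroDivisor : ∀ {d} → ConstantOne d → ∀ z → (d ⊗ z) ≈ [] → z ≈ []
constantOne-noZeroDivisor cd []      _   = ≈-refl
constantOne-noZeroDivisor {d} cd (c ∷ z) dz≈0 =
  ≈-trans (∷-cong c≡0 (constantOne-noZeroDivisor {d} cd z (mk≈ λ i → coeff-≡ (≈-trans shifted dz≈0) (suc i))))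
          shift-[]
  where
  expand : (d ⊗ (c ∷ z)) ≈ (scale c d ⊕ (0ℤ ∷ (d ⊗ z)))
  expand = ⊗-consʳ d c z
  c≡0 : c ≡ 0ℤ
  c≡0 = begin
    c                                    ≡⟨ ℤ.*-identityʳ c ⟨
    c ℤ.* 1ℤ                             ≡⟨ cong (c ℤ.*_) cd ⟨
    c ℤ.* coeff d 0                      ≡⟨ coeff-scale c d 0 ⟨
    coeff (scale c d) 0                  ≡⟨ ℤ.+-identityʳ _ ⟨
    coeff (scale c d) 0 ℤ.+ 0ℤ           ≡⟨ coeff-⊕ (scale c d) (0ℤ ∷ (d ⊗ z)) 0 ⟨
    coeff (scale c d ⊕ (0ℤ ∷ (d ⊗ z))) 0 ≡⟨ coeff-≡ (≈-trans (≈-sym expand) dz≈0) 0 ⟩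
    0ℤ                                   ∎
    where open ≡-Reasoning
  shifted : (0ℤ ∷ (d ⊗ z)) ≈ (d ⊗ (c ∷ z))
  shifted = ≈-sym (≈-trans expand (⊕-cong (scale-zero d c≡0) ≈-refl))

neg : Poly → Poly
neg = scale -1ℤ

⊕-inverseʳ : ∀ w → (w ⊕ neg w) ≈ []
⊕-inverseʳ w = mk≈ λ i → begin
  coeff (w ⊕ neg w) i             ≡⟨ coeff-⊕ w (neg w) i ⟩
  coeff w i ℤ.+ coeff (neg w) i   ≡⟨ cong (λ z → coeff w i ℤ.+ z) (coeff-scale -1ℤ w i) ⟩
  coeff w i ℤ.+ -1ℤ ℤ.* coeff w i ≡⟨ cong (λ z → coeff w i ℤ.+ z) (ℤ.-1*i≡-i (coeff w i)) ⟩
  coeff w i ℤ.- coeff w i         ≡⟨ ℤ.+-inverseʳ (coeff w i) ⟩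
  0ℤ                              ∎
  where open ≡-Reasoning

⊗-cancelˡ : ∀ {d x y} → ConstantOne d → (d ⊗ x) ≈ (d ⊗ y) → x ≈ y
⊗-cancelˡ {d} {x} {y} cd e = mk≈ λ i →
  ℤ.i-j≡0⇒i≡j (coeff x i) (coeff y i) (begin
    coeff x i ℤ.- coeff y i         ≡⟨ cong (λ z → coeff x i ℤ.+ z) (ℤ.-1*i≡-i (coeff y i)) ⟨
    coeff x i ℤ.+ -1ℤ ℤ.* coeff y i ≡⟨ cong (λ z → coeff x i ℤ.+ z) (coeff-scale -1ℤ y i) ⟨
    coeff x i ℤ.+ coeff (neg y) i   ≡⟨ coeff-⊕ x (neg y) i ⟨
    coeff (x ⊕ neg y) i             ≡⟨ coeff-≡ difference≈0 i ⟩
    0ℤ                              ∎)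
  where
  open ≡-Reasoning
  difference≈0 : (x ⊕ neg y) ≈ []
  difference≈0 = constantOne-noZeroDivisor {d} cd (x ⊕ neg y)
    (≈-trans (⊗-distribˡ d x (neg y))
    (≈-trans (⊕-cong e (≈-trans (⊗-comm d (neg y)) (≈-trans (scale-⊗ -1ℤ y d) (scale-cong -1ℤ (⊗-comm y d)))))
             (⊕-inverseʳ (d ⊗ y))))

-- Fractions

infix 4 _≅_
record _≅_ (x y : RatQ) : Set where
  constructor mk≅
  field cross-≈ : (num x ⊗ den y) ≈ (num y ⊗ den x)
open _≅_ public

Proper : RatQ → Set
Proper x = ConstantOne (den x)

≅-refl : ∀ {x} → x ≅ x
≅-refl = mk≅ ≈-refl

≅-sym : ∀ {x y} → x ≅ y → y ≅ x
≅-sym (mk≅ e) = mk≅ (≈-sym e)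

private
  cross₁ : ∀ a d f → (d ⊗ (a ⊗ f)) ≈ ((a ⊗ d) ⊗ f)
  cross₁ = solve-∀ Poly-ring
  cross₂ : ∀ c b f → ((c ⊗ f) ⊗ b) ≈ ((c ⊗ b) ⊗ f)
  cross₂ = solve-∀ Poly-ring
  cross₃ : ∀ e d b → ((e ⊗ b) ⊗ d) ≈ (d ⊗ (e ⊗ b))
  cross₃ = solve-∀ Poly-ring

-- Cross-multiplying the two hypotheses leaves a common factor den y, which cancels.
≅-trans : ∀ {x y z} → Proper y → x ≅ y → y ≅ z → x ≅ z
≅-trans {a / b} {c / d} {e / f} pd (mk≅ x≅y) (mk≅ y≅z) = mk≅ (⊗-cancelˡ {d} pd (begin
  d ⊗ (a ⊗ f) ≈⟨ cross₁ a d f ⟩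
  (a ⊗ d) ⊗ f ≈⟨ ⊗-congˡ f x≅y ⟩
  (c ⊗ b) ⊗ f ≈⟨ cross₂ c b f ⟨
  (c ⊗ f) ⊗ b ≈⟨ ⊗-congˡ b y≅z ⟩
  (e ⊗ d) ⊗ b ≈⟨ cross₂ e d b ⟨
  (e ⊗ b) ⊗ d ≈⟨ cross₃ e d b ⟩
  d ⊗ (e ⊗ b) ∎))
  where open ≈-Reasoning

private
  ⊞-cong-shape : ∀ a b c d b′ d′ →
    (((a ⊗ d) ⊕ (c ⊗ b)) ⊗ (b′ ⊗ d′)) ≈ (((a ⊗ b′) ⊗ (d ⊗ d′)) ⊕ ((c ⊗ d′) ⊗ (b ⊗ b′)))
  ⊞-cong-shape = solve-∀ Poly-ring
  ⊞-cong-shape′ : ∀ a′ b c′ d b′ d′ →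
    (((a′ ⊗ b) ⊗ (d ⊗ d′)) ⊕ ((c′ ⊗ d) ⊗ (b ⊗ b′))) ≈ (((a′ ⊗ d′) ⊕ (c′ ⊗ b′)) ⊗ (b ⊗ d))
  ⊞-cong-shape′ = solve-∀ Poly-ring
  ⊞-assoc-shape : ∀ a b c d e f →
    ((((a ⊗ d) ⊕ (c ⊗ b)) ⊗ f) ⊕ (e ⊗ (b ⊗ d))) ⊗ (b ⊗ (d ⊗ f))
      ≈ ((a ⊗ (d ⊗ f)) ⊕ (((c ⊗ f) ⊕ (e ⊗ d)) ⊗ b)) ⊗ ((b ⊗ d) ⊗ f)
  ⊞-assoc-shape = solve-∀ Poly-ring
  ⊞-common-shape : ∀ a s D → (((a ⊗ D) ⊕ (s ⊗ D)) ⊗ D) ≈ ((a ⊕ s) ⊗ (D ⊗ D))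
  ⊞-common-shape = solve-∀ Poly-ring

⊞-cong : ∀ {x x′ y y′} → x ≅ x′ → y ≅ y′ → (x ⊞ y) ≅ (x′ ⊞ y′)
⊞-cong {a / b} {a′ / b′} {c / d} {c′ / d′} (mk≅ x≅x′) (mk≅ y≅y′) = mk≅
  (≈-trans (⊞-cong-shape a b c d b′ d′)
  (≈-trans (⊕-cong (⊗-congˡ (d ⊗ d′) x≅x′) (⊗-congˡ (b ⊗ b′) y≅y′))
           (⊞-cong-shape′ a′ b c′ d b′ d′)))

⊞-congʳ : ∀ x {y y′} → y ≅ y′ → (x ⊞ y) ≅ (x ⊞ y′)
⊞-congʳ x = ⊞-cong (≅-refl {x})

⊞-identityˡ : ∀ y → (zeroR ⊞ y) ≅ y
⊞-identityˡ (c / d) = mk≅ (≈-trans (⊗-congˡ d (⊗-identityʳ c)) (⊗-congʳ c (≈-sym (⊗-identityˡ d))))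

⊞-assoc : ∀ x y z → ((x ⊞ y) ⊞ z) ≅ (x ⊞ (y ⊞ z))
⊞-assoc (a / b) (c / d) (e / f) = mk≅ (⊞-assoc-shape a b c d e f)

proper-⊞ : ∀ x y → Proper x → Proper y → Proper (x ⊞ y)
proper-⊞ (a / b) (c / d) = constantOne-⊗ {b} {d}

proper-sumR : ∀ {xs} → All Proper xs → Proper (sumR xs)
proper-sumR []                 = refl
proper-sumR {x ∷ xs} (px ∷ ps) = proper-⊞ x (sumR xs) px (proper-sumR ps)

proper-map : ∀ {A : Set} {f : A → RatQ} → (∀ a → Proper (f a)) → ∀ xs → All Proper (map f xs)
proper-map pf xs = All.map⁺ (All.universal pf xs)

sumR-++ : ∀ xs ys → All Proper xs → All Proper ys → sumR (xs ++ ys) ≅ (sumR xs ⊞ sumR ys)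
sumR-++ []       ys _          _   = ≅-sym (⊞-identityˡ (sumR ys))
sumR-++ (x ∷ xs) ys (px ∷ pxs) pys =
  ≅-trans (proper-⊞ x (sumR xs ⊞ sumR ys) px (proper-⊞ (sumR xs) (sumR ys) (proper-sumR pxs) (proper-sumR pys)))
    (⊞-congʳ x (sumR-++ xs ys pxs pys))
    (≅-sym (⊞-assoc x (sumR xs) (sumR ys)))

sumR-map-cong : ∀ {A : Set} {f g : A → RatQ} {xs} → All (λ a → f a ≅ g a) xs →
  sumR (map f xs) ≅ sumR (map g xs)
sumR-map-cong []       = ≅-refl
sumR-map-cong (e ∷ es) = ⊞-cong e (sumR-map-cong es)

sumR-concatMap : ∀ {A : Set} (f : A → List RatQ) xs → (∀ a → All Proper (f a)) →
  sumR (concatMap f xs) ≅ sumR (map (λ a → sumR (f a)) xs)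
sumR-concatMap f []       pf = ≅-refl
sumR-concatMap f (x ∷ xs) pf =
  ≅-trans (proper-⊞ (sumR (f x)) (sumR (concatMap f xs)) (proper-sumR (pf x)) (proper-sumR (concatMap⁺ xs)))
    (sumR-++ (f x) (concatMap f xs) (pf x) (concatMap⁺ xs))
    (⊞-congʳ (sumR (f x)) (sumR-concatMap f xs pf))
  where
  concatMap⁺ : ∀ ys → All Proper (concatMap f ys)
  concatMap⁺ []       = []
  concatMap⁺ (y ∷ ys) = All.++⁺ (pf y) (concatMap⁺ ys)

sumR-filter : ∀ {A : Set} (p : A → Bool) (g : A → RatQ) → (∀ a → Proper (g a)) → ∀ xs →
  sumR (map g (filterᵇ p xs)) ≅ sumR (map (λ a → if p a then g a else zeroR) xs)
sumR-filter p g pg []       = ≅-refl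
sumR-filter p g pg (x ∷ xs) with p x
... | true  = ⊞-congʳ (g x) (sumR-filter p g pg xs)
... | false =
  ≅-trans (proper-sumR (proper-map proper-if xs))
    (sumR-filter p g pg xs) (≅-sym (⊞-identityˡ _))
  where
  proper-if : ∀ a → Proper (if p a then g a else zeroR)
  proper-if a with p a
  ... | true  = pg a
  ... | false = refl

sumP : List Poly → Poly
sumP = foldr _⊕_ []

sumR-commonDen : ∀ {A : Set} (f : A → Poly) {D} → ConstantOne D → ∀ xs →
  sumR (map (λ a → f a / D) xs) ≅ (sumP (map f xs) / D)
sumR-commonDen f cD []           = mk≅ (⊗-identityʳ [])
sumR-commonDen f {D} cD (x ∷ xs) =
  ≅-trans (constantOne-⊗ {D} {D} cD cD)
    (⊞-congʳ (f x / D) (sumR-commonDen f cD xs))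
    (mk≅ (⊞-common-shape (f x) (sumP (map f xs)) D))

onlyIf : Bool → Poly → Poly
onlyIf c p = if c then p else []

sumP-++ : ∀ xs ys → sumP (xs ++ ys) ≈ (sumP xs ⊕ sumP ys)
sumP-++ []       ys = ≈-refl
sumP-++ (x ∷ xs) ys = ≈-trans (⊕-cong (≈-refl {x}) (sumP-++ xs ys)) (≈-sym (⊕-assoc x (sumP xs) (sumP ys)))

sumP-map-cong : ∀ {A : Set} {f g : A → Poly} → (∀ a → f a ≈ g a) → ∀ xs → sumP (map f xs) ≈ sumP (map g xs)
sumP-map-cong f≈g []       = ≈-refl
sumP-map-cong f≈g (x ∷ xs) = ⊕-cong (f≈g x) (sumP-map-cong f≈g xs)

sumP-map-cong-local : ∀ {A : Set} {f g : A → Poly} {xs} → All (λ a → f a ≈ g a) xs → sumP (map f xs) ≈ sumP (map g xs)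
sumP-map-cong-local []       = ≈-refl
sumP-map-cong-local (e ∷ es) = ⊕-cong e (sumP-map-cong-local es)

sumP-concatMap : ∀ {A B : Set} (f : B → Poly) (g : A → List B) xs →
  sumP (map f (concatMap g xs)) ≈ sumP (map (λ a → sumP (map f (g a))) xs)
sumP-concatMap f g []       = ≈-refl
sumP-concatMap f g (x ∷ xs) rewrite List.map-++ f (g x) (concatMap g xs) =
  ≈-trans (sumP-++ (map f (g x)) (map f (concatMap g xs))) (⊕-cong ≈-refl (sumP-concatMap f g xs))

sumP-filter : ∀ {A : Set} (p : A → Bool) (f : A → Poly) xs →
  sumP (map f (filterᵇ p xs)) ≈ sumP (map (λ a → onlyIf (p a) (f a)) xs)
sumP-filter p f []       = ≈-refl
sumP-filter p f (x ∷ xs) with p x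
... | true  = ⊕-cong ≈-refl (sumP-filter p f xs)
... | false = sumP-filter p f xs

sumP-zero : ∀ {A : Set} (xs : List A) → sumP (map (λ _ → []) xs) ≈ []
sumP-zero []       = ≈-refl
sumP-zero (x ∷ xs) = sumP-zero xs

sumP-onlyIf : ∀ {A : Set} c (g : A → Poly) xs → sumP (map (λ a → onlyIf c (g a)) xs) ≈ onlyIf c (sumP (map g xs))
sumP-onlyIf true  g xs = ≈-refl
sumP-onlyIf false g xs = sumP-zero xs

sumP-⊕ : ∀ {A : Set} (f g : A → Poly) xs → sumP (map (λ a → f a ⊕ g a) xs) ≈ (sumP (map f xs) ⊕ sumP (map g xs))
sumP-⊕ f g []       = ≈-refl
sumP-⊕ f g (x ∷ xs) = ≈-trans (⊕-cong ≈-refl (sumP-⊕ f g xs)) (⊕-rearrange (f x) (g x) _ _)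

sumP-swap : ∀ {A B : Set} (f : A → B → Poly) xs ys →
  sumP (map (λ x → sumP (map (f x) ys)) xs) ≈ sumP (map (λ y → sumP (map (λ x → f x y) xs)) ys)
sumP-swap f []       ys = ≈-sym (sumP-zero ys)
sumP-swap f (x ∷ xs) ys =
  ≈-trans (⊕-cong ≈-refl (sumP-swap f xs ys)) (≈-sym (sumP-⊕ (f x) (λ y → sumP (map (λ x → f x y) xs)) ys))

sumP-distribˡ : ∀ {A : Set} c (f : A → Poly) xs → sumP (map (λ a → c ⊗ f a) xs) ≈ (c ⊗ sumP (map f xs))
sumP-distribˡ c f []       = ≈-sym (⊗-zeroʳ c)
sumP-distribˡ c f (x ∷ xs) = ≈-trans (⊕-cong ≈-refl (sumP-distribˡ c f xs)) (≈-sym (⊗-distribˡ c (f x) _))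

sumP-distribʳ : ∀ {A : Set} c (f : A → Poly) xs → (sumP (map f xs) ⊗ c) ≈ sumP (map (λ a → f a ⊗ c) xs)
sumP-distribʳ c f xs =
  ≈-trans (⊗-comm (sumP (map f xs)) c)
  (≈-trans (≈-sym (sumP-distribˡ c f xs)) (sumP-map-cong (λ a → ⊗-comm c (f a)) xs))

true≢false : true ≢ false
true≢false ()

T⇒≡true : ∀ {b} → T b → b ≡ true
T⇒≡true {true} _ = refl

≡true⇒T : ∀ {b} → b ≡ true → T b
≡true⇒T refl = _

∧-eliminˡ : ∀ a {b} → (a ∧ b) ≡ true → a ≡ true
∧-eliminˡ true _ = refl

∧-eliminʳ : ∀ a {b} → (a ∧ b) ≡ true → b ≡ true
∧-eliminʳ true e = e

bool-ext : ∀ {a b} → (a ≡ true → b ≡ true) → (b ≡ true → a ≡ true) → a ≡ b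
bool-ext {true}          a⇒b _   = sym (a⇒b refl)
bool-ext {false} {true}  _   b⇒a = b⇒a refl
bool-ext {false} {false} _   _   = refl

≡ᵇ-refl : ∀ x → (x ≡ᵇ x) ≡ true
≡ᵇ-refl x = T⇒≡true (ℕ.≡⇒≡ᵇ x x refl)

≡ᵇ⇒≡ : ∀ x y → (x ≡ᵇ y) ≡ true → x ≡ y
≡ᵇ⇒≡ x y e = ℕ.≡ᵇ⇒≡ x y (≡true⇒T e)

≡ᵇ-sym : ∀ x y → (x ≡ᵇ y) ≡ (y ≡ᵇ x)
≡ᵇ-sym x y = bool-ext (λ e → ≡⇒≡ᵇ (sym (≡ᵇ⇒≡ x y e))) (λ e → ≡⇒≡ᵇ (sym (≡ᵇ⇒≡ y x e)))
  where
  ≡⇒≡ᵇ : ∀ {x y} → x ≡ y → (x ≡ᵇ y) ≡ true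
  ≡⇒≡ᵇ {x} refl = ≡ᵇ-refl x

≢⇒≡ᵇ-false : ∀ {x y} → x ≢ y → (x ≡ᵇ y) ≡ false
≢⇒≡ᵇ-false {x} {y} x≢y with x ≡ᵇ y in e
... | true  = ⊥-elim (x≢y (≡ᵇ⇒≡ x y e))
... | false = refl

<ᵇ-irrefl : ∀ x → (x <ᵇ x) ≡ false
<ᵇ-irrefl zero    = refl
<ᵇ-irrefl (suc x) = <ᵇ-irrefl x

<⇒<ᵇ : ∀ {x y} → x < y → (x <ᵇ y) ≡ true
<⇒<ᵇ x<y = T⇒≡true (ℕ.<⇒<ᵇ x<y)

<ᵇ⇒< : ∀ x y → (x <ᵇ y) ≡ true → x < y
<ᵇ⇒< x y e = ℕ.<ᵇ⇒< x y (≡true⇒T e)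

≡ᵇ-false⇒≢ : ∀ {x y} → (x ≡ᵇ y) ≡ false → x ≢ y
≡ᵇ-false⇒≢ {x} e refl = true≢false (trans (sym (≡ᵇ-refl x)) e)

≮ᵇ-zero : ∀ {n} → (0 <ᵇ n) ≡ false → n ≡ 0
≮ᵇ-zero {zero} _ = refl

≤⇒≤ᵇ : ∀ {x y} → x ≤ y → (x ≤ᵇ y) ≡ true
≤⇒≤ᵇ x≤y = T⇒≡true (ℕ.≤⇒≤ᵇ x≤y)

≤ᵇ⇒≤ : ∀ x y → (x ≤ᵇ y) ≡ true → x ≤ y
≤ᵇ⇒≤ x y e = ℕ.≤ᵇ⇒≤ x y (≡true⇒T e)

≰ᵇ⇒> : ∀ x y → (x ≤ᵇ y) ≡ false → y < x
≰ᵇ⇒> x y e = ℕ.≰⇒> λ x≤y → true≢false (trans (sym (≤⇒≤ᵇ x≤y)) e)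

≤ᵇ-refl : ∀ x → (x ≤ᵇ x) ≡ true
≤ᵇ-refl x = ≤⇒≤ᵇ (ℕ.≤-refl {x})

countᵇ-++ : ∀ {A : Set} (p : A → Bool) xs ys → countᵇ p (xs ++ ys) ≡ countᵇ p xs + countᵇ p ys
countᵇ-++ p xs ys = trans (cong length (List.filter-++ _ xs ys)) (List.length-++ (filterᵇ p xs))

countᵇ-map : ∀ {A B : Set} (p : B → Bool) (g : A → B) xs → countᵇ p (map g xs) ≡ countᵇ (λ a → p (g a)) xs
countᵇ-map p g []       = refl
countᵇ-map p g (x ∷ xs) with p (g x)
... | true  = cong suc (countᵇ-map p g xs)
... | false = countᵇ-map p g xs

countᵇ-cong : ∀ {A : Set} {p q : A → Bool} → (∀ a → p a ≡ q a) → ∀ xs → countᵇ p xs ≡ countᵇ q xs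
countᵇ-cong {p = p} {q} p≡q []       = refl
countᵇ-cong {p = p} {q} p≡q (x ∷ xs) with p x | q x | p≡q x
... | true  | .true  | refl = cong suc (countᵇ-cong p≡q xs)
... | false | .false | refl = countᵇ-cong p≡q xs

countᵇ-none : ∀ {A : Set} (p : A → Bool) {xs} → All (λ a → p a ≡ false) xs → countᵇ p xs ≡ 0
countᵇ-none p []                   = refl
countᵇ-none p {x ∷ _} (px ∷ pxs) rewrite px = countᵇ-none p pxs

countᵇ-∷-true : ∀ {A : Set} (p : A → Bool) {x} xs → p x ≡ true → countᵇ p (x ∷ xs) ≡ suc (countᵇ p xs)
countᵇ-∷-true p xs px rewrite px = refl

countᵇ-∷-false : ∀ {A : Set} (p : A → Bool) {x} xs → p x ≡ false → countᵇ p (x ∷ xs) ≡ countᵇ p xs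
countᵇ-∷-false p xs px rewrite px = refl

countᵇ-∷ : ∀ {A : Set} (p : A → Bool) x xs → countᵇ p (x ∷ xs) ≡ δ (p x) + countᵇ p xs
countᵇ-∷ p x xs with p x
... | true  = refl
... | false = refl

countᵇ-sum : ∀ {A : Set} (p : A → Bool) xs → countᵇ p xs ≡ sum (map (δ ∘ p) xs)
countᵇ-sum p []       = refl
countᵇ-sum p (x ∷ xs) = trans (countᵇ-∷ p x xs) (cong (δ (p x) +_) (countᵇ-sum p xs))

countᵇ-∧ˡ : ∀ {A : Set} b (p : A → Bool) xs → countᵇ (λ a → b ∧ p a) xs ≡ (if b then countᵇ p xs else 0)
countᵇ-∧ˡ true  p xs = refl
countᵇ-∧ˡ false p xs = countᵇ-none (λ _ → false) (All.universal (λ _ → refl) xs)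

filterᵇ-∷ : ∀ {A : Set} (q : A → Bool) x xs → filterᵇ q (x ∷ xs) ≡ (if q x then x ∷ filterᵇ q xs else filterᵇ q xs)
filterᵇ-∷ q x xs with q x
... | true  = refl
... | false = refl

countᵇ-filterᵇ : ∀ {A : Set} (p q : A → Bool) xs → countᵇ p (filterᵇ q xs) ≡ countᵇ (λ a → q a ∧ p a) xs
countᵇ-filterᵇ p q []       = refl
countᵇ-filterᵇ p q (x ∷ xs) = begin
  countᵇ p (filterᵇ q (x ∷ xs))                             ≡⟨ cong (countᵇ p) (filterᵇ-∷ q x xs) ⟩
  countᵇ p (if q x then x ∷ filterᵇ q xs else filterᵇ q xs) ≡⟨ head (q x) ⟩
  δ (q x ∧ p x) + countᵇ (λ a → q a ∧ p a) xs               ≡⟨ countᵇ-∷ (λ a → q a ∧ p a) x xs ⟨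
  countᵇ (λ a → q a ∧ p a) (x ∷ xs)                         ∎
  where
  open ≡-Reasoning
  head : ∀ b → countᵇ p (if b then x ∷ filterᵇ q xs else filterᵇ q xs) ≡ δ (b ∧ p x) + countᵇ (λ a → q a ∧ p a) xs
  head true  = trans (countᵇ-∷ p x _) (cong (δ (p x) +_) (countᵇ-filterᵇ p q xs))
  head false = countᵇ-filterᵇ p q xs

All-filterᵇ : ∀ {A : Set} (p : A → Bool) xs → All (λ a → p a ≡ true) (filterᵇ p xs)
All-filterᵇ p []       = []
All-filterᵇ p (x ∷ xs) with p x in e
... | true  = e ∷ All-filterᵇ p xs
... | false = All-filterᵇ p xs

prodP : List Poly → Poly
prodP = foldr _⊗_ one

-- aut3 and aut2 are instances of aut, for triples and pairs respectively.
aut : {A : Set} → (A → A → Bool) → List A → Poly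
aut eq ts = prodP (map (λ t → qfact (countᵇ (eq t) ts)) (distinct eq ts))

nonMember : {A : Set} → (A → Bool) → A → Bool
nonMember p y = if p y then false else true

nonMember-false : ∀ {A : Set} (p : A → Bool) {y} → p y ≡ true → nonMember p y ≡ false
nonMember-false p py rewrite py = refl

private
  ⊗-swapˡ : ∀ a b c → (a ⊗ (b ⊗ c)) ≈ (b ⊗ (a ⊗ c))
  ⊗-swapˡ = solve-∀ Poly-ring
  ⊗-swapʳ : ∀ a b c → ((a ⊗ b) ⊗ c) ≈ ((a ⊗ c) ⊗ b)
  ⊗-swapʳ = solve-∀ Poly-ring

prodP-partition : ∀ {A : Set} (F : A → Poly) (p : A → Bool) xs →
  prodP (map F xs) ≈ (prodP (map F (filterᵇ p xs)) ⊗ prodP (map F (filterᵇ (nonMember p) xs)))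
prodP-partition F p []       = ≈-sym (⊗-identityˡ one)
prodP-partition F p (x ∷ xs) with p x
... | true  = ≈-trans (⊗-congʳ (F x) (prodP-partition F p xs))
                      (≈-sym (⊗-assoc (F x) (prodP (map F (filterᵇ p xs))) (prodP (map F (filterᵇ (nonMember p) xs)))))
... | false = ≈-trans (⊗-congʳ (F x) (prodP-partition F p xs))
                      (⊗-swapˡ (F x) (prodP (map F (filterᵇ p xs))) (prodP (map F (filterᵇ (nonMember p) xs))))

prodP-map-cong-local : ∀ {A : Set} {F G : A → Poly} {xs} → All (λ a → F a ≈ G a) xs → prodP (map F xs) ≈ prodP (map G xs)
prodP-map-cong-local []       = ≈-refl
prodP-map-cong-local (e ∷ es) = ⊗-cong e (prodP-map-cong-local es)

module _ {A : Set} (eq : A → A → Bool) (eq-refl : ∀ x → eq x x ≡ true) (eq-sound : ∀ x y → eq x y ≡ true → x ≡ y) where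

  eq-sym-false : ∀ x y → eq x y ≡ false → eq y x ≡ false
  eq-sym-false x y e with eq y x in e′
  ... | false = refl
  ... | true with eq-sound y x e′
  ... | refl = trans (sym (eq-refl x)) e

  filter-filter-⊆ : ∀ (p q : A → Bool) xs → (∀ t → p t ≡ true → q t ≡ true) → filterᵇ p (filterᵇ q xs) ≡ filterᵇ p xs
  filter-filter-⊆ p q []       p⊆q = refl
  filter-filter-⊆ p q (x ∷ xs) p⊆q with q x in qx | p x in px
  ... | true  | true  rewrite px = cong (x ∷_) (filter-filter-⊆ p q xs p⊆q)
  ... | true  | false rewrite px = filter-filter-⊆ p q xs p⊆q
  ... | false | true  = ⊥-elim (true≢false (trans (sym (p⊆q x px)) qx))
  ... | false | false = filter-filter-⊆ p q xs p⊆q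

  filter-filter-disjoint : ∀ (p q : A → Bool) xs → (∀ t → p t ≡ true → q t ≡ false) → filterᵇ p (filterᵇ q xs) ≡ []
  filter-filter-disjoint p q []       p∩q = refl
  filter-filter-disjoint p q (x ∷ xs) p∩q with q x in qx | p x in px
  ... | true  | true  = ⊥-elim (true≢false (trans (sym qx) (p∩q x px)))
  ... | true  | false rewrite px = filter-filter-disjoint p q xs p∩q
  ... | false | _     = filter-filter-disjoint p q xs p∩q

  nonMember-≢ : ∀ x y → eq x y ≡ false → ∀ t → eq x t ≡ true → nonMember (eq y) t ≡ true
  nonMember-≢ x y x≠y t x=t with eq-sound x t x=t
  ... | refl rewrite eq-sym-false x y x≠y = refl

  prodP-filter-distinct : ∀ ts x (F : A → Poly) →
    prodP (map F (filterᵇ (eq x) (distinct eq ts))) ≈ (if countᵇ (eq x) ts ≡ᵇ 0 then one else F x)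
  prodP-filter-distinct []       x F = ≈-refl
  prodP-filter-distinct (y ∷ ts) x F with eq x y in x=y
  ... | true with eq-sound x y x=y
  ...   | refl rewrite filter-filter-disjoint (eq x) (nonMember (eq x)) (distinct eq ts) (λ t → nonMember-false (eq x))
    = ⊗-identityʳ (F x)
  prodP-filter-distinct (y ∷ ts) x F | false
    rewrite filter-filter-⊆ (eq x) (nonMember (eq y)) (distinct eq ts) (nonMember-≢ x y x=y)
    = prodP-filter-distinct ts x F

  aut-∷ : ∀ x ts → aut eq (x ∷ ts) ≈ (aut eq ts ⊗ qint (suc (countᵇ (eq x) ts)))
  aut-∷ x ts = begin
    aut eq (x ∷ ts)
      ≈⟨ ⊗-cong (≡⇒≈ (cong qfact (countᵇ-∷-true (eq x) ts (eq-refl x)))) (prodP-map-cong-local unchanged) ⟩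
    qfact (suc c) ⊗ rest
      ≈⟨ ⊗-swapʳ (qfact c) (qint (suc c)) rest ⟩
    (qfact c ⊗ rest) ⊗ qint (suc c)
      ≈⟨ ⊗-congˡ (qint (suc c)) (⊗-congˡ rest (≈-trans (prodP-filter-distinct ts x G) (qfact-if c))) ⟨
    (prodP (map G (filterᵇ (eq x) D)) ⊗ rest) ⊗ qint (suc c)
      ≈⟨ ⊗-congˡ (qint (suc c)) (prodP-partition G (eq x) D) ⟨
    aut eq ts ⊗ qint (suc c) ∎
    where
    open ≈-Reasoning
    c = countᵇ (eq x) ts
    D = distinct eq ts
    G : A → Poly
    G t = qfact (countᵇ (eq t) ts)
    rest = prodP (map G (filterᵇ (nonMember (eq x)) D))
    unchanged : All (λ t → qfact (countᵇ (eq t) (x ∷ ts)) ≈ G t) (filterᵇ (nonMember (eq x)) D)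
    unchanged = All.map (λ {t} → same t) (All-filterᵇ (nonMember (eq x)) D)
      where
      same : ∀ t → nonMember (eq x) t ≡ true → qfact (countᵇ (eq t) (x ∷ ts)) ≈ G t
      same t e with eq x t in x=t
      ... | false = ≡⇒≈ (cong qfact (countᵇ-∷-false (eq t) ts (eq-sym-false x t x=t)))
    qfact-if : ∀ n → (if n ≡ᵇ 0 then one else qfact n) ≈ qfact n
    qfact-if zero    = ≈-refl
    qfact-if (suc n) = ≈-refl

  aut-++ : ∀ xs ys → All (λ x → countᵇ (eq x) ys ≡ 0) xs → aut eq (xs ++ ys) ≈ (aut eq xs ⊗ aut eq ys)
  aut-++ []       ys []         = ≈-sym (⊗-identityˡ (aut eq ys))
  aut-++ (x ∷ xs) ys (x∉ys ∷ h) = begin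
    aut eq (x ∷ xs ++ ys)                                     ≈⟨ aut-∷ x (xs ++ ys) ⟩
    aut eq (xs ++ ys) ⊗ qint (suc (countᵇ (eq x) (xs ++ ys))) ≈⟨ ⊗-cong (aut-++ xs ys h) (≡⇒≈ (cong (qint ∘ suc) count≡)) ⟩
    (aut eq xs ⊗ aut eq ys) ⊗ qint (suc (countᵇ (eq x) xs))   ≈⟨ ⊗-swapʳ (aut eq xs) (aut eq ys) _ ⟩
    (aut eq xs ⊗ qint (suc (countᵇ (eq x) xs))) ⊗ aut eq ys   ≈⟨ ⊗-congˡ (aut eq ys) (aut-∷ x xs) ⟨
    aut eq (x ∷ xs) ⊗ aut eq ys                               ∎
    where
    open ≈-Reasoning
    count≡ : countᵇ (eq x) (xs ++ ys) ≡ countᵇ (eq x) xs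
    count≡ = trans (countᵇ-++ (eq x) xs ys) (trans (cong (λ z → countᵇ (eq x) xs + z) x∉ys) (ℕ.+-identityʳ _))

  aut-replicate : ∀ n x → aut eq (replicate n x) ≈ qfact n
  aut-replicate zero    x = ≈-refl
  aut-replicate (suc n) x =
    ≈-trans (aut-∷ x (replicate n x)) (⊗-cong (aut-replicate n x) (≡⇒≈ (cong (qint ∘ suc) (count-replicate n))))
    where
    count-replicate : ∀ n → countᵇ (eq x) (replicate n x) ≡ n
    count-replicate zero    = refl
    count-replicate (suc n) = trans (countᵇ-∷-true (eq x) (replicate n x) (eq-refl x)) (cong suc (count-replicate n))

aut-map : ∀ {A B : Set} (eqA : A → A → Bool) (eqB : B → B → Bool) (g : A → B) →
  (∀ x → eqA x x ≡ true) → (∀ x y → eqA x y ≡ true → x ≡ y) →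
  (∀ x → eqB x x ≡ true) → (∀ x y → eqB x y ≡ true → x ≡ y) →
  (∀ x y → eqB (g x) (g y) ≡ eqA x y) → ∀ xs → aut eqB (map g xs) ≈ aut eqA xs
aut-map eqA eqB g reflA soundA reflB soundB g-eq []       = ≈-refl
aut-map eqA eqB g reflA soundA reflB soundB g-eq (x ∷ xs) =
  ≈-trans (aut-∷ eqB reflB soundB (g x) (map g xs))
  (≈-trans (⊗-cong (aut-map eqA eqB g reflA soundA reflB soundB g-eq xs) (≡⇒≈ (cong (qint ∘ suc) count≡)))
           (≈-sym (aut-∷ eqA reflA soundA x xs)))
  where
  count≡ : countᵇ (eqB (g x)) (map g xs) ≡ countᵇ (eqA x) xs
  count≡ = trans (countᵇ-map (eqB (g x)) g xs) (countᵇ-cong (g-eq x) xs)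

==P-refl : ∀ p → (p ==P p) ≡ true
==P-refl (m , a) rewrite ≡ᵇ-refl m | ≡ᵇ-refl a = refl

==P-sound : ∀ p p′ → (p ==P p′) ≡ true → p ≡ p′
==P-sound (m , a) (m′ , a′) e =
  cong₂ _,_ (≡ᵇ⇒≡ m m′ (∧-eliminˡ (m ≡ᵇ m′) e)) (≡ᵇ⇒≡ a a′ (∧-eliminʳ (m ≡ᵇ m′) e))

==T-refl : ∀ t → (t ==T t) ≡ true
==T-refl (m , a , b) rewrite ≡ᵇ-refl m | ≡ᵇ-refl a | ≡ᵇ-refl b = refl

==T-sound : ∀ t t′ → (t ==T t′) ≡ true → t ≡ t′
==T-sound (m , a , b) (m′ , a′ , b′) e =
  cong₂ _,_ (≡ᵇ⇒≡ m m′ (∧-eliminˡ (m ≡ᵇ m′) e)) (==P-sound (a , b) (a′ , b′) (∧-eliminʳ (m ≡ᵇ m′) e))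

autℕ : List ℕ → Poly
autℕ = aut _≡ᵇ_

autℕ-∷ : ∀ x ts → autℕ (x ∷ ts) ≈ (autℕ ts ⊗ qint (suc (countᵇ (x ≡ᵇ_) ts)))
autℕ-∷ = aut-∷ _≡ᵇ_ ≡ᵇ-refl ≡ᵇ⇒≡

-- Words and the q-multinomial theorem

infix 4 _==L_
_==L_ : List ℕ → List ℕ → Bool
[]       ==L []       = true
[]       ==L (_ ∷ _)  = false
(_ ∷ _)  ==L []       = false
(x ∷ xs) ==L (y ∷ ys) = (x ≡ᵇ y) ∧ (xs ==L ys)

==L-refl : ∀ xs → (xs ==L xs) ≡ true
==L-refl []       = refl
==L-refl (x ∷ xs) rewrite ≡ᵇ-refl x = ==L-refl xs

==L-sound : ∀ xs ys → (xs ==L ys) ≡ true → xs ≡ ys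
==L-sound []       []       _ = refl
==L-sound (x ∷ xs) (y ∷ ys) e =
  cong₂ _∷_ (≡ᵇ⇒≡ x y (∧-eliminˡ (x ≡ᵇ y) e)) (==L-sound xs ys (∧-eliminʳ (x ≡ᵇ y) e))

==L-++ : ∀ xs ys us vs → length xs ≡ length us → (xs ++ ys ==L us ++ vs) ≡ ((xs ==L us) ∧ (ys ==L vs))
==L-++ []       ys []       vs _ = refl
==L-++ (x ∷ xs) ys (u ∷ us) vs e with x ≡ᵇ u
... | true  = ==L-++ xs ys us vs (ℕ.suc-injective e)
... | false = refl

Ascending : List ℕ → Set
Ascending = AllPairs _≤_

sort-ascending : ∀ u → Ascending (sort u)
sort-ascending u = Linked⇒AllPairs ℕ.≤-trans (Sort.sort-↗ u)

countᵇ-↭ : ∀ {A : Set} (p : A → Bool) {xs ys} → xs ↭ ys → countᵇ p xs ≡ countᵇ p ys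
countᵇ-↭ p σ = Perm.↭-length (Perm.filter-↭ (T? ∘ p) σ)

sum-map-↭ : ∀ {A : Set} (f : A → ℕ) {xs ys} → xs ↭ ys → sum (map f xs) ≡ sum (map f ys)
sum-map-↭ f σ = sum-↭ (Perm.map⁺ f σ)

insert-head : ∀ x v → All (x ≤_) v → insert x v ≡ x ∷ v
insert-head x []      []          = refl
insert-head x (y ∷ v) (x≤y ∷ _) rewrite ≤⇒≤ᵇ x≤y = refl

multiplicity : ℕ → List ℕ → ℕ
multiplicity x = countᵇ (x ≡ᵇ_)

below : ℕ → List ℕ → ℕ
below x = countᵇ (_<ᵇ x)

inversions : List ℕ → ℕ
inversions []      = 0
inversions (x ∷ u) = below x u + inversions u

inversions-ascending : ∀ v → Ascending v → inversions v ≡ 0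
inversions-ascending []      []         = refl
inversions-ascending (x ∷ v) (x≤v ∷ sv) rewrite inversions-ascending v sv =
  trans (ℕ.+-identityʳ _) (countᵇ-none (_<ᵇ x) (All.map (λ {y} x≤y → not-below y x≤y) x≤v))
  where
  not-below : ∀ y → x ≤ y → (y <ᵇ x) ≡ false
  not-below y x≤y with y <ᵇ x in e
  ... | true  = ⊥-elim (ℕ.<⇒≱ (<ᵇ⇒< y x e) x≤y)
  ... | false = refl

delete : ℕ → List ℕ → List ℕ
delete x []      = []
delete x (y ∷ v) = if y ≡ᵇ x then v else y ∷ delete x v

delete-insert : ∀ x w → delete x (insert x w) ≡ w
delete-insert x []      rewrite ≡ᵇ-refl x = refl
delete-insert x (y ∷ w) with x ≤ᵇ y in e
... | true  rewrite ≡ᵇ-refl x = refl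
... | false rewrite ≢⇒≡ᵇ-false {y} {x} (λ { refl → true≢false (trans (sym (≤ᵇ-refl x)) e) }) =
  cong (y ∷_) (delete-insert x w)

All-delete : ∀ {P : ℕ → Set} x {v} → All P v → All P (delete x v)
All-delete x {[]}    []         = []
All-delete x {y ∷ v} (py ∷ pv) with y ≡ᵇ x
... | true  = pv
... | false = py ∷ All-delete x pv

delete-ascending : ∀ x {v} → Ascending v → Ascending (delete x v)
delete-ascending x {[]}    []          = []
delete-ascending x {y ∷ v} (y≤v ∷ sv) with y ≡ᵇ x
... | true  = sv
... | false = All-delete x y≤v ∷ delete-ascending x sv

Occurs : ℕ → List ℕ → Set
Occurs x v = 0 < multiplicity x v

occurs-tail : ∀ x y v → y ≢ x → Occurs x (y ∷ v) → Occurs x v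
occurs-tail x y v y≢x occ rewrite ≢⇒≡ᵇ-false {x} {y} (λ x≡y → y≢x (sym x≡y)) = occ

All-occurs : ∀ {P : ℕ → Set} x {v} → All P v → Occurs x v → P x
All-occurs x {y ∷ v} (py ∷ pv) occ with x ≡ᵇ y in e
... | true rewrite ≡ᵇ⇒≡ x y e = py
... | false = All-occurs x pv occ

insert-delete : ∀ x v → Ascending v → Occurs x v → insert x (delete x v) ≡ v
insert-delete x (y ∷ v) (y≤v ∷ sv) occ with y ≡ᵇ x in e
... | true rewrite ≡ᵇ⇒≡ y x e = insert-head x v y≤v
... | false with x ≤ᵇ y in x≤ᵇy
...   | true  = ⊥-elim (≡ᵇ-false⇒≢ e (ℕ.≤-antisym (All-occurs x y≤v occ′) (≤ᵇ⇒≤ x y x≤ᵇy)))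
  where occ′ = occurs-tail x y v (≡ᵇ-false⇒≢ e) occ
...   | false = cong (y ∷_) (insert-delete x v sv (occurs-tail x y v (≡ᵇ-false⇒≢ e) occ))

countᵇ-delete : ∀ (p : ℕ → Bool) x v → Occurs x v → countᵇ p v ≡ δ (p x) + countᵇ p (delete x v)
countᵇ-delete p x (y ∷ v) occ with y ≡ᵇ x in e
... | true rewrite ≡ᵇ⇒≡ y x e with p x
...   | true  = refl
...   | false = refl
countᵇ-delete p x (y ∷ v) occ | false with p y
... | true  = trans (cong suc (countᵇ-delete p x v (occurs-tail x y v (≡ᵇ-false⇒≢ e) occ))) (sym (ℕ.+-suc (δ (p x)) _))
... | false = countᵇ-delete p x v (occurs-tail x y v (≡ᵇ-false⇒≢ e) occ)

length-delete : ∀ x v → Occurs x v → suc (length (delete x v)) ≡ length v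
length-delete x v occ = begin
  suc (length (delete x v))              ≡⟨ cong suc (count-all (delete x v)) ⟨
  suc (countᵇ (λ _ → true) (delete x v)) ≡⟨ countᵇ-delete (λ _ → true) x v occ ⟨
  countᵇ (λ _ → true) v                  ≡⟨ count-all v ⟩
  length v                               ∎
  where
  open ≡-Reasoning
  count-all : ∀ (w : List ℕ) → countᵇ (λ _ → true) w ≡ length w
  count-all []      = refl
  count-all (_ ∷ w) = cong suc (count-all w)

==L-insert : ∀ x w v → Ascending v → (insert x w ==L v) ≡ ((0 <ᵇ multiplicity x v) ∧ (w ==L delete x v))
==L-insert x w v sv = bool-ext forward backward
  where
  forward : (insert x w ==L v) ≡ true → ((0 <ᵇ multiplicity x v) ∧ (w ==L delete x v)) ≡ true
  forward e with ==L-sound (insert x w) v e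
  ... | refl rewrite countᵇ-↭ (x ≡ᵇ_) (Sort.insert-↭ x w) | ≡ᵇ-refl x | delete-insert x w = ==L-refl w
  backward : ((0 <ᵇ multiplicity x v) ∧ (w ==L delete x v)) ≡ true → (insert x w ==L v) ≡ true
  backward e with ==L-sound w (delete x v) (∧-eliminʳ (0 <ᵇ multiplicity x v) e)
  ... | refl rewrite insert-delete x v sv (<ᵇ⇒< 0 _ (∧-eliminˡ (0 <ᵇ multiplicity x v) e)) = ==L-refl v

autℕ-delete : ∀ x v → Occurs x v → autℕ v ≈ (autℕ (delete x v) ⊗ qint (multiplicity x v))
autℕ-delete x (y ∷ v) occ with y ≡ᵇ x in e
... | true rewrite ≡ᵇ⇒≡ y x e =
  ≈-trans (autℕ-∷ x v) (⊗-congʳ (autℕ v) (≡⇒≈ (cong qint (sym (countᵇ-∷-true (x ≡ᵇ_) v (≡ᵇ-refl x))))))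
... | false = begin
  autℕ (y ∷ v)
    ≈⟨ autℕ-∷ y v ⟩
  autℕ v ⊗ qint (suc (multiplicity y v))
    ≈⟨ ⊗-congˡ _ (autℕ-delete x v occ′) ⟩
  (autℕ (delete x v) ⊗ qint (multiplicity x v)) ⊗ qint (suc (multiplicity y v))
    ≈⟨ ⊗-swapʳ (autℕ (delete x v)) (qint (multiplicity x v)) _ ⟩
  (autℕ (delete x v) ⊗ qint (suc (multiplicity y v))) ⊗ qint (multiplicity x v)
    ≈⟨ ⊗-congˡ _ (⊗-congʳ (autℕ (delete x v)) (≡⇒≈ (cong (qint ∘ suc) y-unchanged))) ⟩
  (autℕ (delete x v) ⊗ qint (suc (multiplicity y (delete x v)))) ⊗ qint (multiplicity x v)
    ≈⟨ ⊗-congˡ _ (autℕ-∷ y (delete x v)) ⟨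
  autℕ (y ∷ delete x v) ⊗ qint (multiplicity x v)
    ≈⟨ ⊗-congʳ (autℕ (y ∷ delete x v)) (≡⇒≈ (cong qint x-unchanged)) ⟨
  autℕ (y ∷ delete x v) ⊗ qint (multiplicity x (y ∷ v)) ∎
  where
  open ≈-Reasoning
  occ′ = occurs-tail x y v (≡ᵇ-false⇒≢ e) occ
  y-unchanged : multiplicity y v ≡ multiplicity y (delete x v)
  y-unchanged = trans (countᵇ-delete (y ≡ᵇ_) x v occ′) (cong (λ b → δ b + multiplicity y (delete x v)) e)
  x-unchanged : multiplicity x (y ∷ v) ≡ multiplicity x v
  x-unchanged = countᵇ-∷-false (x ≡ᵇ_) v (trans (≡ᵇ-sym x y) e)

qpow-+ : ∀ a b → qpow (a + b) ≈ (qpow a ⊗ qpow b)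
qpow-+ zero    b = ≈-sym (⊗-identityˡ (qpow b))
qpow-+ (suc a) b = ≈-trans (shift-cong (qpow-+ a b)) (≈-sym (⊗-shiftˡ (qpow a) (qpow b)))

qint-+ : ∀ a b → qint (a + b) ≈ (qint a ⊕ (qpow a ⊗ qint b))
qint-+ zero    b = ≈-sym (⊗-identityˡ (qint b))
qint-+ (suc a) b =
  ≈-trans (∷-cong (sym (ℤ.+-identityʳ 1ℤ)) (qint-+ a b))
          (⊕-cong (≈-refl {1ℤ ∷ qint a}) (≈-sym (⊗-shiftˡ (qpow a) (qint b))))

δ-<ᵇ-suc : ∀ y s → δ (y <ᵇ suc s) ≡ δ (y <ᵇ s) + δ (s ≡ᵇ y)
δ-<ᵇ-suc zero    zero    = refl
δ-<ᵇ-suc zero    (suc s) = refl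
δ-<ᵇ-suc (suc y) zero    = refl
δ-<ᵇ-suc (suc y) (suc s) = δ-<ᵇ-suc y s

below-zero : ∀ v → below 0 v ≡ 0
below-zero []      = refl
below-zero (y ∷ v) = below-zero v

below-suc : ∀ s v → below (suc s) v ≡ below s v + multiplicity s v
below-suc s []      = refl
below-suc s (y ∷ v) = begin
  below (suc s) (y ∷ v)                                      ≡⟨ countᵇ-∷ (_<ᵇ suc s) y v ⟩
  δ (y <ᵇ suc s) + below (suc s) v                           ≡⟨ cong₂ _+_ (δ-<ᵇ-suc y s) (below-suc s v) ⟩
  (δ (y <ᵇ s) + δ (s ≡ᵇ y)) + (below s v + multiplicity s v) ≡⟨ ℕ+.interchange (δ (y <ᵇ s)) _ _ _ ⟩
  (δ (y <ᵇ s) + below s v) + (δ (s ≡ᵇ y) + multiplicity s v) ≡⟨ cong₂ _+_ (countᵇ-∷ (_<ᵇ s) y v) (countᵇ-∷ (s ≡ᵇ_) y v) ⟨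
  below s (y ∷ v) + multiplicity s (y ∷ v)                   ∎
  where open ≡-Reasoning

below-all : ∀ M v → All (_< M) v → below M v ≡ length v
below-all M []      []           = refl
below-all M (y ∷ v) (y<M ∷ v<M) rewrite <⇒<ᵇ y<M = cong suc (below-all M v v<M)

-- Σ_{x<M} q^{below x v} [multiplicity x v] telescopes, by [a + b] = [a] + q^a [b].
below-telescope : ∀ v M → sumP (map (λ x → qpow (below x v) ⊗ qint (multiplicity x v)) (upTo M)) ≈ qint (below M v)
below-telescope v zero    = ≡⇒≈ (cong qint (sym (below-zero v)))
below-telescope v (suc M) = begin
  sumP (map f (upTo (suc M)))         ≡⟨ cong (sumP ∘ map f) (List.upTo-∷ʳ M) ⟨
  sumP (map f (upTo M ++ M ∷ []))     ≡⟨ cong sumP (List.map-++ f (upTo M) (M ∷ [])) ⟩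
  sumP (map f (upTo M) ++ f M ∷ [])   ≈⟨ sumP-++ (map f (upTo M)) (f M ∷ []) ⟩
  sumP (map f (upTo M)) ⊕ (f M ⊕ [])  ≈⟨ ⊕-cong (below-telescope v M) (⊕-identityʳ (f M)) ⟩
  qint (below M v) ⊕ f M              ≈⟨ qint-+ (below M v) (multiplicity M v) ⟨
  qint (below M v + multiplicity M v) ≡⟨ cong qint (below-suc M v) ⟨
  qint (below (suc M) v)              ∎
  where
  open ≈-Reasoning
  f : ℕ → Poly
  f x = qpow (below x v) ⊗ qint (multiplicity x v)

sumP-tuples-suc : ∀ (F : List ℕ → Poly) c V →
  sumP (map F (tuples (suc c) V)) ≈ sumP (map (λ x → sumP (map (λ u → F (x ∷ u)) (tuples c V))) V)
sumP-tuples-suc F c V =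
  ≈-trans (sumP-concatMap F (λ x → map (x ∷_) (tuples c V)) V)
          (sumP-map-cong (λ x → ≡⇒≈ (cong sumP (sym (List.map-∘ (tuples c V))))) V)

sortingTo : ℕ → ℕ → List ℕ → Poly
sortingTo M c v = sumP (map (λ u → onlyIf (sort u ==L v) (qpow (inversions u))) (tuples c (upTo M)))

-- Split off the first letter x of u: it must occur in v, contributes q^{below x v}, and
-- the rest of u sorts to v with one x removed.
sortingTo-suc : ∀ M c v → Ascending v →
  sortingTo M (suc c) v ≈
    sumP (map (λ x → onlyIf (0 <ᵇ multiplicity x v) (qpow (below x v) ⊗ sortingTo M c (delete x v))) (upTo M))
sortingTo-suc M c v sv =
  ≈-trans (sumP-tuples-suc (λ u → onlyIf (sort u ==L v) (qpow (inversions u))) c (upTo M))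
          (sumP-map-cong first-letter (upTo M))
  where
  words = tuples c (upTo M)
  first-letter : ∀ x →
    sumP (map (λ u → onlyIf (insert x (sort u) ==L v) (qpow (below x u + inversions u))) words)
      ≈ onlyIf (0 <ᵇ multiplicity x v) (qpow (below x v) ⊗ sortingTo M c (delete x v))
  first-letter x =
    ≈-trans (sumP-map-cong term words)
    (≈-trans (sumP-onlyIf (0 <ᵇ multiplicity x v) (λ u → qpow (below x v) ⊗ onlyIf (sort u ==L delete x v) (qpow (inversions u))) words)
             (onlyIf-cong (0 <ᵇ multiplicity x v) (sumP-distribˡ (qpow (below x v)) _ words)))
    where
    onlyIf-cong : ∀ b {p r} → p ≈ r → onlyIf b p ≈ onlyIf b r
    onlyIf-cong true  e = e
    onlyIf-cong false e = ≈-refl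
    term : ∀ u → onlyIf (insert x (sort u) ==L v) (qpow (below x u + inversions u))
               ≈ onlyIf (0 <ᵇ multiplicity x v) (qpow (below x v) ⊗ onlyIf (sort u ==L delete x v) (qpow (inversions u)))
    term u rewrite ==L-insert x (sort u) v sv
      with 0 <ᵇ multiplicity x v in occ | sort u ==L delete x v in sorts
    ... | false | _     = ≈-refl
    ... | true  | false = ≈-sym (⊗-zeroʳ (qpow (below x v)))
    ... | true  | true  = ≈-trans (qpow-+ (below x u) (inversions u)) (⊗-congˡ (qpow (inversions u)) (≡⇒≈ (cong qpow below≡)))
      where
      below≡ : below x u ≡ below x v
      below≡ = begin
        below x u                         ≡⟨ countᵇ-↭ (_<ᵇ x) (Sort.sort-↭ u) ⟨
        below x (sort u)                  ≡⟨ cong (below x) (==L-sound (sort u) (delete x v) sorts) ⟩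
        below x (delete x v)              ≡⟨ cong (λ b → δ b + below x (delete x v)) (<ᵇ-irrefl x) ⟨
        δ (x <ᵇ x) + below x (delete x v) ≡⟨ countᵇ-delete (_<ᵇ x) x v (<ᵇ⇒< 0 _ occ) ⟨
        below x v                         ∎
        where open ≡-Reasoning

private
  ⊗-middle : ∀ a b c d → ((a ⊗ b) ⊗ (c ⊗ d)) ≈ ((a ⊗ d) ⊗ (b ⊗ c))
  ⊗-middle = solve-∀ Poly-ring

q-multinomial : ∀ M c v → length v ≡ c → Ascending v → All (_< M) v → (sortingTo M c v ⊗ autℕ v) ≈ qfact c
q-multinomial M zero    []  refl []  [] = ≈-trans (⊗-identityʳ _) (⊕-identityʳ one)
q-multinomial M (suc c) v   lv   sv v<M = begin
  sortingTo M (suc c) v ⊗ autℕ v                 ≈⟨ ⊗-congˡ (autℕ v) (sortingTo-suc M c v sv) ⟩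
  sumP (map first (upTo M)) ⊗ autℕ v             ≈⟨ sumP-distribʳ (autℕ v) first (upTo M) ⟩
  sumP (map (λ x → first x ⊗ autℕ v) (upTo M))   ≈⟨ sumP-map-cong per-letter (upTo M) ⟩
  sumP (map (λ x → weight x ⊗ qfact c) (upTo M)) ≈⟨ sumP-distribʳ (qfact c) weight (upTo M) ⟨
  sumP (map weight (upTo M)) ⊗ qfact c           ≈⟨ ⊗-congˡ (qfact c) (below-telescope v M) ⟩
  qint (below M v) ⊗ qfact c                     ≡⟨ cong (λ n → qint n ⊗ qfact c) (trans (below-all M v v<M) lv) ⟩
  qint (suc c) ⊗ qfact c                         ≈⟨ ⊗-comm (qint (suc c)) (qfact c) ⟩
  qfact (suc c)                                  ∎
  where
  open ≈-Reasoning
  first weight : ℕ → Poly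
  first x = onlyIf (0 <ᵇ multiplicity x v) (qpow (below x v) ⊗ sortingTo M c (delete x v))
  weight x = qpow (below x v) ⊗ qint (multiplicity x v)
  per-letter : ∀ x → (first x ⊗ autℕ v) ≈ (weight x ⊗ qfact c)
  per-letter x with 0 <ᵇ multiplicity x v in occ
  ... | false = ≈-sym (⊗-congˡ (qfact c)
    (≈-trans (⊗-congʳ (qpow (below x v)) (≡⇒≈ (cong qint (≮ᵇ-zero occ)))) (⊗-zeroʳ (qpow (below x v)))))
  ... | true  = begin
    (qpow (below x v) ⊗ sortingTo M c (delete x v)) ⊗ autℕ v
      ≈⟨ ⊗-congʳ (qpow (below x v) ⊗ sortingTo M c (delete x v)) (autℕ-delete x v x∈v) ⟩
    (qpow (below x v) ⊗ sortingTo M c (delete x v)) ⊗ (autℕ (delete x v) ⊗ qint (multiplicity x v))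
      ≈⟨ ⊗-middle (qpow (below x v)) _ _ _ ⟩
    weight x ⊗ (sortingTo M c (delete x v) ⊗ autℕ (delete x v))
      ≈⟨ ⊗-congʳ (weight x) (q-multinomial M c (delete x v) length≡ (delete-ascending x sv) (All-delete x v<M)) ⟩
    weight x ⊗ qfact c ∎
    where
    x∈v : Occurs x v
    x∈v = <ᵇ⇒< 0 _ occ
    length≡ : length (delete x v) ≡ c
    length≡ = ℕ.suc-injective (trans (length-delete x v x∈v) lv)

upTo-< : ∀ M → All (_< M) (upTo M)
upTo-< M = All.applyUpTo⁺₁ (λ i → i) M (λ i<M → i<M)

tuples-All : ∀ {P : ℕ → Set} n {V} → All P V → All (λ t → length t ≡ n × All P t) (tuples n V)
tuples-All zero    pV = (refl , []) ∷ []
tuples-All (suc n) pV =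
  All.concat⁺ (All.map⁺ (All.map (λ pv → All.map⁺ (All.map (λ (l , pt) → cong suc l , pv ∷ pt) (tuples-All n pV))) pV))

sumP-tuples-+ : ∀ (F : List ℕ → Poly) c n V →
  sumP (map F (tuples (c + n) V)) ≈ sumP (map (λ t₁ → sumP (map (λ t₂ → F (t₁ ++ t₂)) (tuples n V))) (tuples c V))
sumP-tuples-+ F zero    n V = ≈-sym (⊕-identityʳ _)
sumP-tuples-+ F (suc c) n V =
  ≈-trans (sumP-tuples-suc F (c + n) V)
  (≈-trans (sumP-map-cong (λ x → sumP-tuples-+ (λ u → F (x ∷ u)) c n V) V)
           (≈-sym (sumP-tuples-suc (λ t₁ → sumP (map (λ t₂ → F (t₁ ++ t₂)) (tuples n V))) c V)))

multiplicity-upTo : ∀ y M → multiplicity y (upTo M) ≡ δ (y <ᵇ M)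
multiplicity-upTo y zero    = refl
multiplicity-upTo y (suc M) = begin
  multiplicity y (upTo (suc M))                     ≡⟨ cong (multiplicity y) (List.upTo-∷ʳ M) ⟨
  multiplicity y (upTo M ++ M ∷ [])                 ≡⟨ countᵇ-++ (y ≡ᵇ_) (upTo M) (M ∷ []) ⟩
  multiplicity y (upTo M) + multiplicity y (M ∷ []) ≡⟨ cong₂ _+_ (multiplicity-upTo y M) (countᵇ-∷ (y ≡ᵇ_) M []) ⟩
  δ (y <ᵇ M) + (δ (y ≡ᵇ M) + 0)                     ≡⟨ cong (λ b → δ (y <ᵇ M) + (δ b + 0)) (≡ᵇ-sym y M) ⟩
  δ (y <ᵇ M) + (δ (M ≡ᵇ y) + 0)                     ≡⟨ cong (λ z → δ (y <ᵇ M) + z) (ℕ.+-identityʳ _) ⟩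
  δ (y <ᵇ M) + δ (M ≡ᵇ y)                           ≡⟨ δ-<ᵇ-suc y M ⟨
  δ (y <ᵇ suc M)                                    ∎
  where open ≡-Reasoning

countᵇ-tuples-suc : ∀ y x W V →
  countᵇ ((y ∷ x) ==L_) (concatMap (λ v → map (v ∷_) W) V) ≡ multiplicity y V * countᵇ (x ==L_) W
countᵇ-tuples-suc y x W []      = refl
countᵇ-tuples-suc y x W (v ∷ V) = begin
  countᵇ ((y ∷ x) ==L_) (map (v ∷_) W ++ concatMap (λ v → map (v ∷_) W) V)
    ≡⟨ countᵇ-++ ((y ∷ x) ==L_) (map (v ∷_) W) _ ⟩
  countᵇ ((y ∷ x) ==L_) (map (v ∷_) W) + countᵇ ((y ∷ x) ==L_) (concatMap (λ v → map (v ∷_) W) V)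
    ≡⟨ cong₂ _+_ (trans (countᵇ-map ((y ∷ x) ==L_) (v ∷_) W) (countᵇ-∧ˡ (y ≡ᵇ v) (x ==L_) W)) (countᵇ-tuples-suc y x W V) ⟩
  (if y ≡ᵇ v then countᵇ (x ==L_) W else 0) + multiplicity y V * countᵇ (x ==L_) W
    ≡⟨ head-term (y ≡ᵇ v) ⟩
  (δ (y ≡ᵇ v) + multiplicity y V) * countᵇ (x ==L_) W
    ≡⟨ cong (λ z → z * countᵇ (x ==L_) W) (countᵇ-∷ (y ≡ᵇ_) v V) ⟨
  multiplicity y (v ∷ V) * countᵇ (x ==L_) W ∎
  where
  open ≡-Reasoning
  head-term : ∀ b → (if b then countᵇ (x ==L_) W else 0) + multiplicity y V * countᵇ (x ==L_) W
                  ≡ (δ b + multiplicity y V) * countᵇ (x ==L_) W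
  head-term true  = refl
  head-term false = refl

countᵇ-tuples : ∀ M n x → length x ≡ n → All (_< M) x → countᵇ (x ==L_) (tuples n (upTo M)) ≡ 1
countᵇ-tuples M zero    []      refl []          = refl
countᵇ-tuples M (suc n) (y ∷ x) refl (y<M ∷ x<M) = begin
  countᵇ ((y ∷ x) ==L_) (tuples (suc n) (upTo M))               ≡⟨ countᵇ-tuples-suc y x _ (upTo M) ⟩
  multiplicity y (upTo M) * countᵇ (x ==L_) (tuples n (upTo M)) ≡⟨ cong₂ _*_ (multiplicity-upTo y M) (countᵇ-tuples M n x refl x<M) ⟩
  δ (y <ᵇ M) * 1                                                ≡⟨ cong (λ b → δ b * 1) (<⇒<ᵇ y<M) ⟩
  1                                                             ∎
  where open ≡-Reasoning

-- Splitting dinv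

attackInversion : ℕ → Triple × Triple → Bool
attackInversion k ((mi , ai , bi) , (mj , aj , bj)) = attacks k ((mi , ai) , (mj , aj)) ∧ (bi >ᵇ bj)

unlabel : Triple → Triple
unlabel (m , a , _) = (m , a , 1)

∸-+-δ : ∀ X Y d → (X + δ d) ∸ Y ≡ (X + 0) ∸ Y + δ ((Y ≤ᵇ X) ∧ d)
∸-+-δ X Y false with Y ≤ᵇ X
... | true  = sym (ℕ.+-identityʳ _)
... | false = sym (ℕ.+-identityʳ _)
∸-+-δ X Y true with Y ≤ᵇ X in Y≤X
... | true  = trans (ℕ.+-∸-comm 1 (≤ᵇ⇒≤ Y X Y≤X)) (cong (λ z → z ∸ Y + 1) (sym (ℕ.+-identityʳ X)))
... | false = trans (ℕ.m≤n⇒m∸n≡0 (subst (_≤ Y) (ℕ.+-comm 1 X) (≰ᵇ⇒> Y X Y≤X)))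
                    (sym (trans (ℕ.+-identityʳ _) (trans (cong (_∸ Y) (ℕ.+-identityʳ X)) (ℕ.m≤n⇒m∸n≡0 (ℕ.<⇒≤ (≰ᵇ⇒> Y X Y≤X))))))

dinvTerm-split : ∀ k t u → dinvTerm k (t , u) ≡ dinvTerm k (unlabel t , unlabel u) + δ (attackInversion k (t , u))
dinvTerm-split k (m , a , b) (m′ , a′ , b′) = ∸-+-δ (m′ + k + δ (a >ᵇ a′)) (m + 1) (b >ᵇ b′)

sum-map-+δ : ∀ {A : Set} {f g : A → ℕ} (p : A → Bool) → (∀ a → f a ≡ g a + δ (p a)) → ∀ xs →
  sum (map f xs) ≡ sum (map g xs) + countᵇ p xs
sum-map-+δ p f≡ []       = refl
sum-map-+δ {f = f} {g} p f≡ (x ∷ xs) = begin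
  f x + sum (map f xs)                             ≡⟨ cong₂ _+_ (f≡ x) (sum-map-+δ p f≡ xs) ⟩
  (g x + δ (p x)) + (sum (map g xs) + countᵇ p xs) ≡⟨ ℕ+.interchange (g x) _ _ _ ⟩
  (g x + sum (map g xs)) + (δ (p x) + countᵇ p xs) ≡⟨ cong (λ z → g x + sum (map g xs) + z) (countᵇ-∷ p x xs) ⟨
  sum (map g (x ∷ xs)) + countᵇ p (x ∷ xs)         ∎
  where open ≡-Reasoning

pairs-map : ∀ {A B : Set} (g : A → B) xs → pairs (map g xs) ≡ map (λ (x , y) → (g x , g y)) (pairs xs)
pairs-map g []       = refl
pairs-map g (x ∷ xs) = begin
  map (g x ,_) (map g xs) ++ pairs (map g xs)
    ≡⟨ cong₂ _++_ (trans (sym (List.map-∘ xs)) (List.map-∘ xs)) (pairs-map g xs) ⟩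
  map g² (map (x ,_) xs) ++ map g² (pairs xs)
    ≡⟨ List.map-++ g² (map (x ,_) xs) (pairs xs) ⟨
  map g² (map (x ,_) xs ++ pairs xs) ∎
  where
  open ≡-Reasoning
  g² = λ (x , y) → (g x , g y)

zip3-unlabel : ∀ ms as bs → length ms ≡ length bs → length as ≡ length bs →
  zip3 ms as (replicate (length ms) 1) ≡ map unlabel (zip3 ms as bs)
zip3-unlabel []       []       []       _  _  = refl
zip3-unlabel (m ∷ ms) (a ∷ as) (b ∷ bs) e₁ e₂ =
  cong ((m , a , 1) ∷_) (zip3-unlabel ms as bs (ℕ.suc-injective e₁) (ℕ.suc-injective e₂))

dinv-split : ∀ k ms as bs → length ms ≡ length bs → length as ≡ length bs →
  dinv3 k ms as bs ≡ dinv2 k ms as + invD k ms as bs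
dinv-split k ms as bs e₁ e₂ = begin
  sum (map (dinvTerm k) (pairs L))
    ≡⟨ sum-map-+δ (attackInversion k) (λ (t , u) → dinvTerm-split k t u) (pairs L) ⟩
  sum (map (λ (t , u) → dinvTerm k (unlabel t , unlabel u)) (pairs L)) + invD k ms as bs
    ≡⟨ cong (λ ps → sum ps + invD k ms as bs) (List.map-∘ (pairs L)) ⟩
  sum (map (dinvTerm k) (map (λ (t , u) → (unlabel t , unlabel u)) (pairs L))) + invD k ms as bs
    ≡⟨ cong (λ ps → sum (map (dinvTerm k) ps) + invD k ms as bs)
            (trans (sym (pairs-map unlabel L)) (cong pairs (sym (zip3-unlabel ms as bs e₁ e₂)))) ⟩
  dinv2 k ms as + invD k ms as bs ∎
  where
  open ≡-Reasoning
  L = zip3 ms as bs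

Holds : {A : Set} → (A × A → Bool) → A → A → Set
Holds r x y = r (x , y) ≡ true

and-map⇒All : ∀ {A : Set} (p : A → Bool) xs → and (map p xs) ≡ true → All (λ x → p x ≡ true) xs
and-map⇒All p []       _ = []
and-map⇒All p (x ∷ xs) e with p x in px
... | true = px ∷ and-map⇒All p xs e

All⇒and-map : ∀ {A : Set} (p : A → Bool) {xs} → All (λ x → p x ≡ true) xs → and (map p xs) ≡ true
All⇒and-map p []         = refl
All⇒and-map p (px ∷ pxs) rewrite px = All⇒and-map p pxs

and-pairs⇒AllPairs : ∀ {A : Set} (r : A × A → Bool) xs → and (map r (pairs xs)) ≡ true → AllPairs (Holds r) xs
and-pairs⇒AllPairs r []       _ = []
and-pairs⇒AllPairs r (x ∷ xs) e
  with All.++⁻ (map (x ,_) xs) (and-map⇒All r (map (x ,_) xs ++ pairs xs) e)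
... | head , rest = All.map⁻ head ∷ and-pairs⇒AllPairs r xs (All⇒and-map r rest)

AllPairs⇒and-pairs : ∀ {A : Set} (r : A × A → Bool) {xs} → AllPairs (Holds r) xs → and (map r (pairs xs)) ≡ true
AllPairs⇒and-pairs r []            = refl
AllPairs⇒and-pairs r (rx ∷ rxs) =
  All⇒and-map r (All.++⁺ (All.map⁺ rx) (and-map⇒All r _ (AllPairs⇒and-pairs r rxs)))

AllPairs-++⁻ : ∀ {A : Set} {R : A → A → Set} xs {ys} → AllPairs R (xs ++ ys) →
  AllPairs R xs × All (λ x → All (R x) ys) xs × AllPairs R ys
AllPairs-++⁻ []       rys        = [] , [] , rys
AllPairs-++⁻ (x ∷ xs) (rx ∷ rxs) with AllPairs-++⁻ xs rxs
... | rxs′ , cross , rys = (All.++⁻ˡ xs rx ∷ rxs′) , (All.++⁻ʳ xs rx ∷ cross) , rys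

SortedTriples : List Triple → Set
SortedTriples = AllPairs (Holds sortedPairT)

SortedPairs : List (ℕ × ℕ) → Set
SortedPairs = AllPairs (Holds sortedPairP)

sorted3⇔ : ∀ ms as bs → (sorted3 ms as bs ≡ true → SortedTriples (zip3 ms as bs))
                      × (SortedTriples (zip3 ms as bs) → sorted3 ms as bs ≡ true)
sorted3⇔ ms as bs = and-pairs⇒AllPairs sortedPairT (zip3 ms as bs) , AllPairs⇒and-pairs sortedPairT

block : ℕ → ℕ → ℕ → Triple
block m a x = (m , a , x)

sortedPairT-block : ∀ m a x y → sortedPairT (block m a x , block m a y) ≡ (x ≤ᵇ y)
sortedPairT-block m a x y rewrite ≤ᵇ-refl m | ≡ᵇ-refl m | ≤ᵇ-refl a | ≡ᵇ-refl a = refl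

SortedTriples-block⁻ : ∀ m a {t} → SortedTriples (map (block m a) t) → Ascending t
SortedTriples-block⁻ m a s =
  AllPairs.map (λ {x} {y} e → ≤ᵇ⇒≤ x y (trans (sym (sortedPairT-block m a x y)) e)) (AllPairs.map⁻ s)

SortedTriples-block⁺ : ∀ m a {t} → Ascending t → SortedTriples (map (block m a) t)
SortedTriples-block⁺ m a s =
  AllPairs.map⁺ (AllPairs.map (λ {x} {y} x≤y → trans (sortedPairT-block m a x y) (≤⇒≤ᵇ x≤y)) s)

project : Triple → ℕ × ℕ
project (m , a , _) = (m , a)

sortedPairT⇒sortedPairP : ∀ t u → sortedPairT (t , u) ≡ true → sortedPairP (project t , project u) ≡ true
sortedPairT⇒sortedPairP (m , a , x) (m′ , a′ , y) e with m′ ≤ᵇ m | m ≡ᵇ m′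
... | true | false = refl
... | true | true with a ≤ᵇ a′
...   | true = refl

zip-project : ∀ (ms as bs : List ℕ) → length ms ≡ length bs → length as ≡ length bs →
  zip ms as ≡ map project (zip3 ms as bs)
zip-project []       []       []       _  _  = refl
zip-project (m ∷ ms) (a ∷ as) (b ∷ bs) e₁ e₂ =
  cong ((m , a) ∷_) (zip-project ms as bs (ℕ.suc-injective e₁) (ℕ.suc-injective e₂))

sorted3⇒sorted2 : ∀ ms as bs → length ms ≡ length bs → length as ≡ length bs →
  sorted3 ms as bs ≡ true → sorted2 ms as ≡ true
sorted3⇒sorted2 ms as bs e₁ e₂ s =
  AllPairs⇒and-pairs sortedPairP (subst SortedPairs (sym (zip-project ms as bs e₁ e₂))
    (AllPairs.map⁺ (AllPairs.map (λ {t} {u} → sortedPairT⇒sortedPairP t u) (proj₁ (sorted3⇔ ms as bs) s))))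

Precedes : ℕ × ℕ → ℕ × ℕ → Set
Precedes p p′ = Holds sortedPairP p p′ × (p ==P p′) ≡ false

-- Maximal runs of equal entries of (zip ms as), each run preceding everything after it.
data Blocks : List ℕ → List ℕ → Set where
  []   : Blocks [] []
  cons : ∀ m a c {ms as} → All (Precedes (m , a)) (zip ms as) → Blocks ms as →
         Blocks (replicate (suc c) m ++ ms) (replicate (suc c) a ++ as)

sortBlocks : ∀ {ms as} → Blocks ms as → List ℕ → List ℕ
sortBlocks []                b = b
sortBlocks (cons m a c _ bl) b = sort (take (suc c) b) ++ sortBlocks bl (drop (suc c) b)

sortBlocks-↭ : ∀ {ms as} (bl : Blocks ms as) b → sortBlocks bl b ↭ b
sortBlocks-↭ []                b = ↭-refl
sortBlocks-↭ (cons m a c prec bl) b =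
  subst (sortBlocks (cons m a c prec bl) b ↭_) (List.take++drop≡id (suc c) b)
        (Perm.++⁺ (Sort.sort-↭ (take (suc c) b)) (sortBlocks-↭ bl (drop (suc c) b)))

zip-replicate-++ : ∀ {A B : Set} n (m : A) (a : B) ms as → zip (replicate n m ++ ms) (replicate n a ++ as) ≡ replicate n (m , a) ++ zip ms as
zip-replicate-++ zero    m a ms as = refl
zip-replicate-++ (suc n) m a ms as = cong ((m , a) ∷_) (zip-replicate-++ n m a ms as)

zip3-replicate-++ : ∀ n m a ms as (b₁ b₂ : List ℕ) → length b₁ ≡ n →
  zip3 (replicate n m ++ ms) (replicate n a ++ as) (b₁ ++ b₂) ≡ map (block m a) b₁ ++ zip3 ms as b₂
zip3-replicate-++ zero    m a ms as []       b₂ _ = refl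
zip3-replicate-++ (suc n) m a ms as (x ∷ b₁) b₂ e = cong (block m a x ∷_) (zip3-replicate-++ n m a ms as b₁ b₂ (ℕ.suc-injective e))

All-zip3 : ∀ {P : ℕ × ℕ → Set} ms as bs → All P (zip ms as) → All (P ∘ project) (zip3 ms as bs)
All-zip3 []       _        _        _          = []
All-zip3 (m ∷ ms) []       _        _          = []
All-zip3 (m ∷ ms) (a ∷ as) []       _          = []
All-zip3 (m ∷ ms) (a ∷ as) (b ∷ bs) (p ∷ ps) = p ∷ All-zip3 ms as bs ps

length-replicate-++ : ∀ {A : Set} n (x : A) ms → length (replicate n x ++ ms) ≡ n + length ms
length-replicate-++ n x ms = trans (List.length-++ (replicate n x)) (cong (_+ length ms) (List.length-replicate n))

module SplitAt (n n′ : ℕ) (b : List ℕ) (lb : length b ≡ n + n′) where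
  length-take : length (take n b) ≡ n
  length-take = trans (List.length-take n b) (trans (cong (λ l → n ⊓ l) lb) (ℕ.m≤n⇒m⊓n≡m (ℕ.m≤m+n n n′)))
  length-drop : length (drop n b) ≡ n′
  length-drop = trans (List.length-drop n b) (trans (cong (_∸ n) lb) (ℕ.m+n∸m≡n n n′))

sortedPairT-precedes : ∀ m a x t → Precedes (m , a) (project t) → Holds sortedPairT (block m a x) t
sortedPairT-precedes m a x (m′ , a′ , y) (sp , ne) with m′ ≤ᵇ m | m ≡ᵇ m′
... | true  | false = refl
... | false | _     = sp
... | true  | true with a ≤ᵇ a′ | a ≡ᵇ a′
...   | true  | false = refl
...   | false | _     = sp
...   | true  | true  = ⊥-elim (true≢false ne)

SortedTriples-block-++⁻ : ∀ n m a ms as b₁ b₂ → length b₁ ≡ n →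
  SortedTriples (zip3 (replicate n m ++ ms) (replicate n a ++ as) (b₁ ++ b₂)) → Ascending b₁ × SortedTriples (zip3 ms as b₂)
SortedTriples-block-++⁻ n m a ms as b₁ b₂ lb₁ s
  with AllPairs-++⁻ (map (block m a) b₁) (subst SortedTriples (zip3-replicate-++ n m a ms as b₁ b₂ lb₁) s)
... | s₁ , _ , s₂ = SortedTriples-block⁻ m a s₁ , s₂

sortBlocks-sorted : ∀ {ms as} (bl : Blocks ms as) b → length b ≡ length ms → SortedTriples (zip3 ms as (sortBlocks bl b))
sortBlocks-sorted []                 b lb = []
sortBlocks-sorted (cons m a c {ms} {as} prec bl) b lb =
  subst SortedTriples (sym (zip3-replicate-++ C m a ms as (sort (take C b)) _ (trans (Perm.↭-length (Sort.sort-↭ (take C b))) length-take)))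
    (AllPairs.++⁺ (SortedTriples-block⁺ m a (sort-ascending (take C b)))
                  (sortBlocks-sorted bl (drop C b) length-drop)
                  (All.map⁺ (All.universal (λ x → All.map (λ {t} → sortedPairT-precedes m a x t) (All-zip3 ms as _ prec)) _)))
  where
  C = suc c
  open SplitAt C (length ms) b (trans lb (length-replicate-++ C m ms))

sortedPairP-antisym : ∀ p q → Holds sortedPairP p q → Holds sortedPairP q p → p ≡ q
sortedPairP-antisym (m , a) (m′ , a′) pq qp
  with ℕ.≤-antisym (≤ᵇ⇒≤ m′ m (∧-eliminˡ (m′ ≤ᵇ m) pq)) (≤ᵇ⇒≤ m m′ (∧-eliminˡ (m ≤ᵇ m′) qp))
... | refl rewrite ≤ᵇ-refl m | ≡ᵇ-refl m = cong (m ,_) (ℕ.≤-antisym (≤ᵇ⇒≤ a a′ pq) (≤ᵇ⇒≤ a′ a qp))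

Blocks-∷ : ∀ m a {ms as} → All (Holds sortedPairP (m , a)) (zip ms as) → Blocks ms as → Blocks (m ∷ ms) (a ∷ as)
Blocks-∷ m a _ [] = cons m a 0 [] []
Blocks-∷ m a ordered (cons m′ a′ c {ms} {as} prec bl) with (m , a) ==P (m′ , a′) in new
... | true with ==P-sound (m , a) (m′ , a′) new
...   | refl = cons m a (suc c) prec bl
Blocks-∷ m a ordered (cons m′ a′ c {ms} {as} prec bl) | false =
  cons m a 0 (subst (All (Precedes (m , a))) (sym (zip-replicate-++ (suc c) m′ a′ ms as))
                    (All.++⁺ (All.replicate⁺ (suc c) (before-block , new)) (All.zipWith precedes-rest (ordered-rest , prec))))
             (cons m′ a′ c prec bl)
  where
  ordered′ = All.++⁻ (replicate (suc c) (m′ , a′)) (subst (All (Holds sortedPairP (m , a))) (zip-replicate-++ (suc c) m′ a′ ms as) ordered)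
  before-block : Holds sortedPairP (m , a) (m′ , a′)
  before-block with proj₁ ordered′
  ... | o ∷ _ = o
  ordered-rest = proj₂ ordered′
  precedes-rest : ∀ {q} → Holds sortedPairP (m , a) q × Precedes (m′ , a′) q → Precedes (m , a) q
  precedes-rest {q} (o , (o′ , ne)) with (m , a) ==P q in e
  ... | false = o , refl
  ... | true with ==P-sound (m , a) q e
  ...   | refl with sortedPairP-antisym (m , a) (m′ , a′) before-block o′
  ...     | refl = ⊥-elim (true≢false (trans (sym (==P-refl (m , a))) new))

sorted2⇒Blocks : ∀ ms as → length ms ≡ length as → sorted2 ms as ≡ true → Blocks ms as
sorted2⇒Blocks ms as e s = build ms as e (and-pairs⇒AllPairs sortedPairP (zip ms as) s)
  where
  build : ∀ ms as → length ms ≡ length as → SortedPairs (zip ms as) → Blocks ms as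
  build []       []       _ _          = []
  build (m ∷ ms) (a ∷ as) e (o ∷ os) = Blocks-∷ m a o (build ms as (ℕ.suc-injective e) os)


sum-map-+ : ∀ {A : Set} (f g : A → ℕ) xs → sum (map (λ x → f x + g x) xs) ≡ sum (map f xs) + sum (map g xs)
sum-map-+ f g []       = refl
sum-map-+ f g (x ∷ xs) = trans (cong (f x + g x +_) (sum-map-+ f g xs)) (ℕ+.interchange (f x) (g x) _ _)

sum-map-zero : ∀ {A : Set} (xs : List A) → sum (map (λ _ → 0) xs) ≡ 0
sum-map-zero []       = refl
sum-map-zero (_ ∷ xs) = sum-map-zero xs

sum-swap : ∀ {A B : Set} (f : A → B → ℕ) xs ys →
  sum (map (λ x → sum (map (f x) ys)) xs) ≡ sum (map (λ y → sum (map (λ x → f x y) xs)) ys)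
sum-swap f []       ys = sym (sum-map-zero ys)
sum-swap f (x ∷ xs) ys =
  trans (cong (sum (map (f x) ys) +_) (sum-swap f xs ys)) (sym (sum-map-+ (f x) (λ y → sum (map (λ x → f x y) xs)) ys))

countᵇ-pairs-++ : ∀ {A : Set} (p : A × A → Bool) xs ys →
  countᵇ p (pairs (xs ++ ys)) ≡ countᵇ p (pairs xs) + (sum (map (λ x → sum (map (λ y → δ (p (x , y))) ys)) xs) + countᵇ p (pairs ys))
countᵇ-pairs-++ p []       ys = refl
countᵇ-pairs-++ p (x ∷ xs) ys = begin
  countᵇ p (map (x ,_) (xs ++ ys) ++ pairs (xs ++ ys))
    ≡⟨ countᵇ-++ p (map (x ,_) (xs ++ ys)) _ ⟩
  countᵇ p (map (x ,_) (xs ++ ys)) + countᵇ p (pairs (xs ++ ys))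
    ≡⟨ cong₂ _+_ (trans (cong (countᵇ p) (List.map-++ (x ,_) xs ys)) (countᵇ-++ p (map (x ,_) xs) (map (x ,_) ys)))
                 (countᵇ-pairs-++ p xs ys) ⟩
  (countᵇ p (map (x ,_) xs) + countᵇ p (map (x ,_) ys)) + (countᵇ p (pairs xs) + (cross xs + countᵇ p (pairs ys)))
    ≡⟨ rearrange (countᵇ p (map (x ,_) xs)) _ _ _ _ ⟩
  (countᵇ p (map (x ,_) xs) + countᵇ p (pairs xs)) + (countᵇ p (map (x ,_) ys) + cross xs + countᵇ p (pairs ys))
    ≡⟨ cong₂ (λ u v → u + (v + cross xs + countᵇ p (pairs ys)))
             (sym (countᵇ-++ p (map (x ,_) xs) (pairs xs)))
             (trans (countᵇ-map p (x ,_) ys) (countᵇ-sum (λ y → p (x , y)) ys)) ⟩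
  countᵇ p (pairs (x ∷ xs)) + (cross (x ∷ xs) + countᵇ p (pairs ys)) ∎
  where
  open ≡-Reasoning
  cross : List _ → ℕ
  cross zs = sum (map (λ z → sum (map (λ y → δ (p (z , y))) ys)) zs)
  rearrange : ∀ a b c d e → (a + b) + (c + (d + e)) ≡ (a + c) + (b + d + e)
  rearrange = ℕ-solve-∀

-- This is where k ≥ 1 is used.
attacks-within-block : ∀ k → 1 ≤ k → ∀ m a → attacks k ((m , a) , (m , a)) ≡ true
attacks-within-block k k≥1 m a rewrite <ᵇ-irrefl a =
  ≤⇒≤ᵇ (subst (m + 1 ≤_) (sym (ℕ.+-identityʳ (m + k))) (ℕ.+-monoʳ-≤ m k≥1))

invD-block : ∀ k → 1 ≤ k → ∀ m a t → countᵇ (attackInversion k) (pairs (map (block m a) t)) ≡ inversions t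
invD-block k k≥1 m a []      = refl
invD-block k k≥1 m a (x ∷ t) =
  trans (countᵇ-++ (attackInversion k) (map (block m a x ,_) (map (block m a) t)) _)
        (cong₂ _+_ (trans (cong (countᵇ (attackInversion k)) (sym (List.map-∘ t)))
                          (trans (countᵇ-map (attackInversion k) (λ y → block m a x , block m a y) t)
                                 (countᵇ-cong same-block t)))
                   (invD-block k k≥1 m a t))
  where
  same-block : ∀ y → attackInversion k (block m a x , block m a y) ≡ (y <ᵇ x)
  same-block y rewrite attacks-within-block k k≥1 m a = refl

weightedInv : ℕ → (Triple → ℕ) → List ℕ → List ℕ → List ℕ → ℕ
weightedInv k w ms as b = invD k ms as b + sum (map w (zip3 ms as b))

weightedInv-zero : ∀ k ms as b → weightedInv k (λ _ → 0) ms as b ≡ invD k ms as b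
weightedInv-zero k ms as b = trans (cong (invD k ms as b +_) (sum-map-zero (zip3 ms as b))) (ℕ.+-identityʳ _)

weightedInv-cong : ∀ k {w w′} → (∀ τ → w τ ≡ w′ τ) → ∀ ms as b → weightedInv k w ms as b ≡ weightedInv k w′ ms as b
weightedInv-cong k w≡w′ ms as b = cong (λ z → invD k ms as b + sum z) (List.map-cong w≡w′ (zip3 ms as b))

blockWeight : (Triple → ℕ) → ℕ → ℕ → List ℕ → ℕ
blockWeight w m a t = sum (map (w ∘ block m a) t)

-- The weight seen by the later letters once the block (m, a) carries the labels t.
throughBlock : ℕ → (Triple → ℕ) → ℕ → ℕ → List ℕ → Triple → ℕ
throughBlock k w m a t τ = w τ + sum (map (λ x → δ (attackInversion k (block m a x , τ))) t)

blockWeight-↭ : ∀ w m a {t t′} → t ↭ t′ → blockWeight w m a t ≡ blockWeight w m a t′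
blockWeight-↭ w m a = sum-map-↭ (w ∘ block m a)

throughBlock-↭ : ∀ k w m a {t t′} → t ↭ t′ → ∀ τ → throughBlock k w m a t τ ≡ throughBlock k w m a t′ τ
throughBlock-↭ k w m a σ τ = cong (w τ +_) (sum-map-↭ (λ x → δ (attackInversion k (block m a x , τ))) σ)

weightedInv-block : ∀ k → 1 ≤ k → ∀ n m a ms as w t₁ t₂ → length t₁ ≡ n →
  weightedInv k w (replicate n m ++ ms) (replicate n a ++ as) (t₁ ++ t₂)
    ≡ inversions t₁ + (blockWeight w m a t₁ + weightedInv k (throughBlock k w m a t₁) ms as t₂)
weightedInv-block k k≥1 n m a ms as w t₁ t₂ lt₁ = begin
  weightedInv k w (replicate n m ++ ms) (replicate n a ++ as) (t₁ ++ t₂)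
    ≡⟨ cong (λ L → countᵇ Q (pairs L) + sum (map w L)) (zip3-replicate-++ n m a ms as t₁ t₂ lt₁) ⟩
  countᵇ Q (pairs (L₁ ++ L₂)) + sum (map w (L₁ ++ L₂))
    ≡⟨ cong₂ _+_ (countᵇ-pairs-++ Q L₁ L₂) (trans (cong sum (List.map-++ w L₁ L₂)) (sum-++ (map w L₁) _)) ⟩
  (countᵇ Q (pairs L₁) + (cross + countᵇ Q (pairs L₂))) + (sum (map w L₁) + sum (map w L₂))
    ≡⟨ cong₂ (λ i x → (i + (x + countᵇ Q (pairs L₂))) + (sum (map w L₁) + sum (map w L₂))) (invD-block k k≥1 m a t₁) cross≡ ⟩
  (inversions t₁ + (X + countᵇ Q (pairs L₂))) + (sum (map w L₁) + sum (map w L₂))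
    ≡⟨ cong (λ z → (inversions t₁ + (X + countᵇ Q (pairs L₂))) + (sum z + sum (map w L₂))) (List.map-∘ t₁) ⟨
  (inversions t₁ + (X + countᵇ Q (pairs L₂))) + (blockWeight w m a t₁ + sum (map w L₂))
    ≡⟨ rearrange (inversions t₁) X _ (blockWeight w m a t₁) _ ⟩
  inversions t₁ + (blockWeight w m a t₁ + (countᵇ Q (pairs L₂) + (sum (map w L₂) + X)))
    ≡⟨ cong (λ z → inversions t₁ + (blockWeight w m a t₁ + (countᵇ Q (pairs L₂) + z))) (sum-map-+ w attacked L₂) ⟨
  inversions t₁ + (blockWeight w m a t₁ + weightedInv k (throughBlock k w m a t₁) ms as t₂) ∎
  where
  open ≡-Reasoning
  Q  = attackInversion k
  L₁ = map (block m a) t₁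
  L₂ = zip3 ms as t₂
  attacked : Triple → ℕ
  attacked τ = sum (map (λ x → δ (Q (block m a x , τ))) t₁)
  X  = sum (map attacked L₂)
  cross = sum (map (λ s → sum (map (λ τ → δ (Q (s , τ))) L₂)) L₁)
  cross≡ : cross ≡ X
  cross≡ = trans (cong sum (sym (List.map-∘ t₁))) (sum-swap (λ x τ → δ (Q (block m a x , τ))) t₁ L₂)
  rearrange : ∀ i x j A y → (i + (x + j)) + (A + y) ≡ i + (A + (j + (y + x)))
  rearrange = ℕ-solve-∀

==T-block : ∀ m a x t → Precedes (m , a) (project t) → (block m a x ==T t) ≡ false
==T-block m a x (m′ , a′ , y) (_ , ne) with m ≡ᵇ m′
... | false = refl
... | true with a ≡ᵇ a′
...   | false = refl

aut3-block-++ : ∀ n m a ms as b₁ b₂ → All (Precedes (m , a)) (zip ms as) → length b₁ ≡ n →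
  aut3 (replicate n m ++ ms) (replicate n a ++ as) (b₁ ++ b₂) ≈ (autℕ b₁ ⊗ aut3 ms as b₂)
aut3-block-++ n m a ms as b₁ b₂ prec lb₁ = begin
  aut _==T_ (zip3 (replicate n m ++ ms) (replicate n a ++ as) (b₁ ++ b₂))
    ≡⟨ cong (aut _==T_) (zip3-replicate-++ n m a ms as b₁ b₂ lb₁) ⟩
  aut _==T_ (map (block m a) b₁ ++ zip3 ms as b₂)
    ≈⟨ aut-++ _==T_ ==T-refl ==T-sound (map (block m a) b₁) (zip3 ms as b₂) disjoint ⟩
  aut _==T_ (map (block m a) b₁) ⊗ aut3 ms as b₂
    ≈⟨ ⊗-congˡ (aut3 ms as b₂) (aut-map _≡ᵇ_ _==T_ (block m a) ≡ᵇ-refl ≡ᵇ⇒≡ ==T-refl ==T-sound same-block b₁) ⟩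
  autℕ b₁ ⊗ aut3 ms as b₂ ∎
  where
  open ≈-Reasoning
  disjoint : All (λ t → countᵇ (t ==T_) (zip3 ms as b₂) ≡ 0) (map (block m a) b₁)
  disjoint = All.map⁺ (All.universal (λ x →
    countᵇ-none (block m a x ==T_) (All.map (λ {t} → ==T-block m a x t) (All-zip3 ms as b₂ prec))) b₁)
  same-block : ∀ x y → (block m a x ==T block m a y) ≡ (x ≡ᵇ y)
  same-block x y rewrite ≡ᵇ-refl m | ≡ᵇ-refl a = refl

aut2-block-++ : ∀ n m a ms as → All (Precedes (m , a)) (zip ms as) →
  aut2 (replicate n m ++ ms) (replicate n a ++ as) ≈ (qfact n ⊗ aut2 ms as)
aut2-block-++ n m a ms as prec = begin
  aut _==P_ (zip (replicate n m ++ ms) (replicate n a ++ as))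
    ≡⟨ cong (aut _==P_) (zip-replicate-++ n m a ms as) ⟩
  aut _==P_ (replicate n (m , a) ++ zip ms as)
    ≈⟨ aut-++ _==P_ ==P-refl ==P-sound (replicate n (m , a)) (zip ms as) disjoint ⟩
  aut _==P_ (replicate n (m , a)) ⊗ aut2 ms as
    ≈⟨ ⊗-congˡ (aut2 ms as) (aut-replicate _==P_ ==P-refl ==P-sound n (m , a)) ⟩
  qfact n ⊗ aut2 ms as ∎
  where
  open ≈-Reasoning
  disjoint : All (λ p → countᵇ (p ==P_) (zip ms as) ≡ 0) (replicate n (m , a))
  disjoint = All.replicate⁺ n (countᵇ-none ((m , a) ==P_) (All.map proj₂ prec))

take-++ : ∀ {A : Set} n (xs ys : List A) → length xs ≡ n → take n (xs ++ ys) ≡ xs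
take-++ zero    []       ys _ = refl
take-++ (suc n) (x ∷ xs) ys e = cong (x ∷_) (take-++ n xs ys (ℕ.suc-injective e))

drop-++ : ∀ {A : Set} n (xs ys : List A) → length xs ≡ n → drop n (xs ++ ys) ≡ ys
drop-++ zero    []       ys _ = refl
drop-++ (suc n) (x ∷ xs) ys e = drop-++ n xs ys (ℕ.suc-injective e)



times : ℕ → Poly → Poly
times zero    v = []
times (suc n) v = v ⊕ times n v

sumP-onlyIf-==L : ∀ x v L → sumP (map (λ b → onlyIf (x ==L b) v) L) ≈ times (countᵇ (x ==L_) L) v
sumP-onlyIf-==L x v []      = ≈-refl
sumP-onlyIf-==L x v (b ∷ L) with x ==L b
... | true  = ⊕-cong ≈-refl (sumP-onlyIf-==L x v L)
... | false = sumP-onlyIf-==L x v L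



countᵇ-==L-filterᵇ : ∀ x (Q : List ℕ → Bool) xs → countᵇ (x ==L_) (filterᵇ Q xs) ≡ (if Q x then countᵇ (x ==L_) xs else 0)
countᵇ-==L-filterᵇ x Q xs =
  trans (countᵇ-filterᵇ (x ==L_) Q xs) (trans (countᵇ-cong only-x xs) (countᵇ-∧ˡ (Q x) (x ==L_) xs))
  where
  only-x : ∀ b → (Q b ∧ (x ==L b)) ≡ (Q x ∧ (x ==L b))
  only-x b with x ==L b in x=b
  ... | true rewrite ==L-sound x b x=b = refl
  ... | false = trans (∧-zeroʳ (Q b)) (sym (∧-zeroʳ (Q x)))

all-↭ : ∀ (f : ℕ → Bool) {xs ys} → xs ↭ ys → all f xs ≡ all f ys
all-↭ f {xs} {ys} σ = bool-ext
  (λ e → All⇒and-map f (Perm.All-resp-↭ σ (and-map⇒All f xs e)))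
  (λ e → All⇒and-map f (Perm.All-resp-↭ (↭-sym σ) (and-map⇒All f ys e)))

sameContent-↭ : ∀ {xs xs′} ys → xs ↭ xs′ → sameContent xs ys ≡ sameContent xs′ ys
sameContent-↭ {xs} {xs′} ys σ =
  cong₂ _∧_ (cong (_≡ᵇ length ys) (Perm.↭-length σ))
            (trans (cong and (List.map-cong same-counts (xs ++ ys))) (all-↭ (test xs′) (Perm.++⁺ʳ ys σ)))
  where
  test : List ℕ → ℕ → Bool
  test zs v = countᵇ (v ≡ᵇ_) zs ≡ᵇ countᵇ (v ≡ᵇ_) ys
  same-counts : ∀ v → test xs v ≡ test xs′ v
  same-counts v = cong (_≡ᵇ countᵇ (v ≡ᵇ_) ys) (countᵇ-↭ (v ≡ᵇ_) σ)


-- Block sums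

module BlockSums (k : ℕ) (k≥1 : 1 ≤ k) (M : ℕ) where

  summand : ∀ {ms as} → Blocks ms as → (Triple → ℕ) → List ℕ → List ℕ → Poly
  summand {ms} {as} bl w b b′ = onlyIf (sortBlocks bl b′ ==L b) (qpow (weightedInv k w ms as b′))

  blockSum : ∀ {ms as} → Blocks ms as → (Triple → ℕ) → List ℕ → Poly
  blockSum {ms} bl w b = sumP (map (summand bl w b) (tuples (length ms) (upTo M)))

  firstBlock : List ℕ → List ℕ → Poly
  firstBlock b₁ t₁ = onlyIf (sort t₁ ==L b₁) (qpow (inversions t₁))

  -- Once the labels t₁ of the first block sort to b₁, they contribute through their own
  -- inversions, their weights, and their attacks on the later blocks.
  summand-cons : ∀ m a c {ms as} (prec : All (Precedes (m , a)) (zip ms as)) (bl : Blocks ms as) w b₁ b₂ t₁ t₂ →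
    length b₁ ≡ suc c → length t₁ ≡ suc c →
    summand (cons m a c prec bl) w (b₁ ++ b₂) (t₁ ++ t₂)
      ≈ (firstBlock b₁ t₁ ⊗ (qpow (blockWeight w m a b₁) ⊗ summand bl (throughBlock k w m a b₁) b₂ t₂))
  summand-cons m a c {ms} {as} prec bl w b₁ b₂ t₁ t₂ lb₁ lt₁
    rewrite take-++ (suc c) t₁ t₂ lt₁ | drop-++ (suc c) t₁ t₂ lt₁
          | ==L-++ (sort t₁) (sortBlocks bl t₂) b₁ b₂ (trans (Perm.↭-length (Sort.sort-↭ t₁)) (trans lt₁ (sym lb₁)))
          | weightedInv-block k k≥1 (suc c) m a ms as w t₁ t₂ lt₁
    with sort t₁ ==L b₁ in sorts | sortBlocks bl t₂ ==L b₂
  ... | false | _     = ≈-refl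
  ... | true  | false =
    ≈-sym (≈-trans (⊗-congʳ (qpow (inversions t₁)) (⊗-zeroʳ (qpow (blockWeight w m a b₁)))) (⊗-zeroʳ (qpow (inversions t₁))))
  ... | true  | true  =
    ≈-trans (≡⇒≈ (cong (λ z → qpow (inversions t₁ + z))
                       (cong₂ _+_ (blockWeight-↭ w m a t₁↭b₁) (weightedInv-cong k (throughBlock-↭ k w m a t₁↭b₁) ms as t₂))))
    (≈-trans (qpow-+ (inversions t₁) _) (⊗-congʳ (qpow (inversions t₁)) (qpow-+ (blockWeight w m a b₁) _)))
    where
    t₁↭b₁ : t₁ ↭ b₁
    t₁↭b₁ = subst (t₁ ↭_) (==L-sound (sort t₁) b₁ sorts) (↭-sym (Sort.sort-↭ t₁))

  blockSum-cons : ∀ m a c {ms as} (prec : All (Precedes (m , a)) (zip ms as)) (bl : Blocks ms as) w b₁ b₂ →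
    length b₁ ≡ suc c →
    blockSum (cons m a c prec bl) w (b₁ ++ b₂)
      ≈ (sortingTo M (suc c) b₁ ⊗ (qpow (blockWeight w m a b₁) ⊗ blockSum bl (throughBlock k w m a b₁) b₂))
  blockSum-cons m a c {ms} {as} prec bl w b₁ b₂ lb₁ = begin
    sumP (map F (tuples (length (replicate C m ++ ms)) V))
      ≡⟨ cong (λ n → sumP (map F (tuples n V))) (length-replicate-++ C m ms) ⟩
    sumP (map F (tuples (C + length ms) V))
      ≈⟨ sumP-tuples-+ F C (length ms) V ⟩
    sumP (map (λ t₁ → sumP (map (λ t₂ → F (t₁ ++ t₂)) (tuples (length ms) V))) (tuples C V))
      ≈⟨ sumP-map-cong-local (All.map (λ {t₁} (lt₁ , _) → first-block t₁ lt₁) (tuples-All C (upTo-< M))) ⟩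
    sumP (map (λ t₁ → firstBlock b₁ t₁ ⊗ (qA ⊗ rest)) (tuples C V))
      ≈⟨ sumP-distribʳ (qA ⊗ rest) (firstBlock b₁) (tuples C V) ⟨
    sortingTo M C b₁ ⊗ (qA ⊗ rest) ∎
    where
    open ≈-Reasoning
    C = suc c
    V = upTo M
    F = summand (cons m a c prec bl) w (b₁ ++ b₂)
    later = summand bl (throughBlock k w m a b₁) b₂
    qA = qpow (blockWeight w m a b₁)
    rest = blockSum bl (throughBlock k w m a b₁) b₂
    first-block : ∀ t₁ → length t₁ ≡ C → sumP (map (λ t₂ → F (t₁ ++ t₂)) (tuples (length ms) V)) ≈ (firstBlock b₁ t₁ ⊗ (qA ⊗ rest))
    first-block t₁ lt₁ =
      ≈-trans (sumP-map-cong (λ t₂ → summand-cons m a c prec bl w b₁ b₂ t₁ t₂ lb₁ lt₁) (tuples (length ms) V))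
      (≈-trans (sumP-distribˡ (firstBlock b₁ t₁) (λ t₂ → qA ⊗ later t₂) (tuples (length ms) V))
               (⊗-congʳ (firstBlock b₁ t₁) (sumP-distribˡ qA later (tuples (length ms) V))))

  BlockSumAut : ∀ {ms as} → Blocks ms as → Set
  BlockSumAut {ms} {as} bl = ∀ w b → length b ≡ length ms → SortedTriples (zip3 ms as b) → All (_< M) b →
    (blockSum bl w b ⊗ aut3 ms as b) ≈ (qpow (weightedInv k w ms as b) ⊗ aut2 ms as)

  private
    ⊗-regroup₁ : ∀ s q o u v → ((s ⊗ (q ⊗ o)) ⊗ (u ⊗ v)) ≈ ((s ⊗ u) ⊗ (q ⊗ (o ⊗ v)))
    ⊗-regroup₁ = solve-∀ Poly-ring
    ⊗-regroup₂ : ∀ f q e p → (f ⊗ (q ⊗ (e ⊗ p))) ≈ ((q ⊗ e) ⊗ (f ⊗ p))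
    ⊗-regroup₂ = solve-∀ Poly-ring

  -- The first block contributes [size]! / Π [multiplicity]! by the q-multinomial theorem.
  blockSum-aut-cons : ∀ m a c {ms as} (prec : All (Precedes (m , a)) (zip ms as)) (bl : Blocks ms as) →
    BlockSumAut bl → ∀ w b₁ b₂ → length b₁ ≡ suc c → length b₂ ≡ length ms →
    SortedTriples (zip3 (replicate (suc c) m ++ ms) (replicate (suc c) a ++ as) (b₁ ++ b₂)) →
    All (_< M) b₁ → All (_< M) b₂ →
    (blockSum (cons m a c prec bl) w (b₁ ++ b₂) ⊗ aut3 (replicate (suc c) m ++ ms) (replicate (suc c) a ++ as) (b₁ ++ b₂))
      ≈ (qpow (weightedInv k w (replicate (suc c) m ++ ms) (replicate (suc c) a ++ as) (b₁ ++ b₂))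
         ⊗ aut2 (replicate (suc c) m ++ ms) (replicate (suc c) a ++ as))
  blockSum-aut-cons m a c {ms} {as} prec bl rest-aut w b₁ b₂ lb₁ lb₂ sorted b₁<M b₂<M = begin
    blockSum (cons m a c prec bl) w (b₁ ++ b₂) ⊗ aut3 MS AS (b₁ ++ b₂)
      ≈⟨ ⊗-cong (blockSum-cons m a c prec bl w b₁ b₂ lb₁) (aut3-block-++ C m a ms as b₁ b₂ prec lb₁) ⟩
    (sortingTo M C b₁ ⊗ (qA ⊗ rest)) ⊗ (autℕ b₁ ⊗ aut3 ms as b₂)
      ≈⟨ ⊗-regroup₁ (sortingTo M C b₁) qA rest (autℕ b₁) (aut3 ms as b₂) ⟩
    (sortingTo M C b₁ ⊗ autℕ b₁) ⊗ (qA ⊗ (rest ⊗ aut3 ms as b₂))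
      ≈⟨ ⊗-cong (q-multinomial M C b₁ lb₁ ascending b₁<M) (⊗-congʳ qA (rest-aut w₂ b₂ lb₂ rest-sorted b₂<M)) ⟩
    qfact C ⊗ (qA ⊗ (qpow (weightedInv k w₂ ms as b₂) ⊗ aut2 ms as))
      ≈⟨ ⊗-regroup₂ (qfact C) qA (qpow (weightedInv k w₂ ms as b₂)) (aut2 ms as) ⟩
    (qA ⊗ qpow (weightedInv k w₂ ms as b₂)) ⊗ (qfact C ⊗ aut2 ms as)
      ≈⟨ ⊗-cong (qpow-+ (blockWeight w m a b₁) _) (aut2-block-++ C m a ms as prec) ⟨
    qpow (blockWeight w m a b₁ + weightedInv k w₂ ms as b₂) ⊗ aut2 MS AS
      ≡⟨ cong (λ z → qpow z ⊗ aut2 MS AS) weightedInv≡ ⟨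
    qpow (weightedInv k w MS AS (b₁ ++ b₂)) ⊗ aut2 MS AS ∎
    where
    open ≈-Reasoning
    C = suc c
    MS = replicate C m ++ ms
    AS = replicate C a ++ as
    ascending = proj₁ (SortedTriples-block-++⁻ C m a ms as b₁ b₂ lb₁ sorted)
    rest-sorted = proj₂ (SortedTriples-block-++⁻ C m a ms as b₁ b₂ lb₁ sorted)
    qA = qpow (blockWeight w m a b₁)
    w₂ = throughBlock k w m a b₁
    rest = blockSum bl w₂ b₂
    weightedInv≡ : weightedInv k w MS AS (b₁ ++ b₂) ≡ blockWeight w m a b₁ + weightedInv k w₂ ms as b₂
    weightedInv≡ = trans (weightedInv-block k k≥1 C m a ms as w b₁ b₂ lb₁)
                         (cong (_+ (blockWeight w m a b₁ + weightedInv k w₂ ms as b₂)) (inversions-ascending b₁ ascending))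

  blockSum-aut : ∀ {ms as} (bl : Blocks ms as) → BlockSumAut bl
  blockSum-aut [] w [] refl [] [] = ⊗-congˡ one (⊕-identityʳ (qpow (weightedInv k w [] [] [])))
  blockSum-aut (cons m a c {ms} {as} prec bl) w b lb sorted b<M =
    subst (λ b → (blockSum (cons m a c prec bl) w b ⊗ aut3 MS AS b) ≈ (qpow (weightedInv k w MS AS b) ⊗ aut2 MS AS))
          (List.take++drop≡id C b)
          (blockSum-aut-cons m a c prec bl (blockSum-aut bl) w (take C b) (drop C b) length-take length-drop
            (subst (λ b → SortedTriples (zip3 MS AS b)) (sym (List.take++drop≡id C b)) sorted)
            (All.take⁺ C b<M) (All.drop⁺ C b<M))
    where
    C = suc c
    MS = replicate C m ++ ms
    AS = replicate C a ++ as
    open SplitAt C (length ms) b (trans lb (length-replicate-++ C m ms))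

  -- b′ is counted exactly once, at b = sortBlocks bl b′, provided b′ has content β.
  sortBlocks-hits : ∀ {ms as} (bl : Blocks ms as) β b′ → length b′ ≡ length ms → All (_< M) b′ → ∀ v →
    sumP (map (λ b → onlyIf (sortBlocks bl b′ ==L b) v) (filterᵇ (λ b → sameContent b β ∧ sorted3 ms as b) (tuples (length ms) (upTo M))))
      ≈ onlyIf (sameContent b′ β) v
  sortBlocks-hits {ms} {as} bl β b′ lb′ b′<M v = begin
    sumP (map (λ b → onlyIf (x ==L b) v) (filterᵇ wanted W))
      ≈⟨ sumP-onlyIf-==L x v (filterᵇ wanted W) ⟩
    times (countᵇ (x ==L_) (filterᵇ wanted W)) v
      ≡⟨ cong (λ n → times n v) (countᵇ-==L-filterᵇ x wanted W) ⟩
    times (if wanted x then countᵇ (x ==L_) W else 0) v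
      ≡⟨ cong₂ (λ c n → times (if c then n else 0) v) wanted-x once ⟩
    times (if sameContent b′ β then 1 else 0) v
      ≈⟨ times-if (sameContent b′ β) ⟩
    onlyIf (sameContent b′ β) v ∎
    where
    open ≈-Reasoning
    W = tuples (length ms) (upTo M)
    wanted : List ℕ → Bool
    wanted b = sameContent b β ∧ sorted3 ms as b
    x = sortBlocks bl b′
    x↭b′ = sortBlocks-↭ bl b′
    wanted-x : wanted x ≡ sameContent b′ β
    wanted-x = trans (cong₂ _∧_ (sameContent-↭ β x↭b′) (proj₂ (sorted3⇔ ms as x) (sortBlocks-sorted bl b′ lb′)))
                     (∧-identityʳ (sameContent b′ β))
    once : countᵇ (x ==L_) W ≡ 1
    once = countᵇ-tuples M (length ms) x (trans (Perm.↭-length x↭b′) lb′) (Perm.All-resp-↭ (↭-sym x↭b′) b′<M)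
    times-if : ∀ c → times (if c then 1 else 0) v ≈ onlyIf c v
    times-if true  = ⊕-identityʳ v
    times-if false = ≈-refl

  blockSum-content : ∀ {ms as} (bl : Blocks ms as) β → length β ≡ length ms →
    sumP (map (blockSum bl (λ _ → 0)) (filterᵇ (λ b → sameContent b β ∧ sorted3 ms as b) (tuples (length ms) (upTo M))))
      ≈ sumP (map (λ b → qpow (invD k ms as b)) (filterᵇ (λ b → sameContent b β) (tuples (length β) (upTo M))))
  blockSum-content {ms} {as} bl β lβ = begin
    sumP (map (λ b → sumP (map (λ b′ → onlyIf (sortBlocks bl b′ ==L b) (g b′)) W)) sorted)
      ≈⟨ sumP-swap (λ b b′ → onlyIf (sortBlocks bl b′ ==L b) (g b′)) sorted W ⟩
    sumP (map (λ b′ → sumP (map (λ b → onlyIf (sortBlocks bl b′ ==L b) (g b′)) sorted)) W)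
      ≈⟨ sumP-map-cong-local (All.map (λ {b′} (lb′ , b′<M) → sortBlocks-hits bl β b′ lb′ b′<M (g b′))
                                      (tuples-All (length ms) (upTo-< M))) ⟩
    sumP (map (λ b′ → onlyIf (sameContent b′ β) (g b′)) W)
      ≈⟨ sumP-filter (λ b → sameContent b β) g W ⟨
    sumP (map g (filterᵇ (λ b → sameContent b β) W))
      ≡⟨ cong sumP (List.map-cong (λ b′ → cong qpow (weightedInv-zero k ms as b′)) (filterᵇ (λ b → sameContent b β) W)) ⟩
    sumP (map (λ b → qpow (invD k ms as b)) (filterᵇ (λ b → sameContent b β) W))
      ≡⟨ cong (λ n → sumP (map (λ b → qpow (invD k ms as b)) (filterᵇ (λ b → sameContent b β) (tuples n (upTo M))))) lβ ⟨
    sumP (map (λ b → qpow (invD k ms as b)) (filterᵇ (λ b → sameContent b β) (tuples (length β) (upTo M)))) ∎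
    where
    open ≈-Reasoning
    W = tuples (length ms) (upTo M)
    sorted = filterᵇ (λ b → sameContent b β ∧ sorted3 ms as b) W
    g : List ℕ → Poly
    g b′ = qpow (weightedInv k (λ _ → 0) ms as b′)

constantOne-aut : ∀ {A : Set} (eq : A → A → Bool) ts → ConstantOne (aut eq ts)
constantOne-aut eq ts = go (distinct eq ts)
  where
  go : ∀ D → ConstantOne (prodP (map (λ t → qfact (countᵇ (eq t) ts)) D))
  go []      = refl
  go (d ∷ D) = constantOne-⊗ {qfact (countᵇ (eq d) ts)} (constantOne-qfact (countᵇ (eq d) ts)) (go D)

constantOne-denominator : ∀ n d → ConstantOne d → ConstantOne (polyPow oneMinusQ n ⊗ d)
constantOne-denominator n d = constantOne-⊗ {polyPow oneMinusQ n} {d} (constantOne-polyPow n refl)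

private
  ⊗-interchange : ∀ a b c d → ((a ⊗ b) ⊗ (c ⊗ d)) ≈ ((a ⊗ c) ⊗ (b ⊗ d))
  ⊗-interchange = solve-∀ Poly-ring

sortedPair-contribution : ∀ k → 1 ≤ k → ∀ ms as β → length as ≡ length ms → length β ≡ length ms → sorted2 ms as ≡ true →
  sumR (map (λ bs → qpow (dinv3 k ms as bs) / (polyPow oneMinusQ (length ms) ⊗ aut3 ms as bs))
            (filterᵇ (λ bs → sameContent bs β ∧ sorted3 ms as bs) (tuples (length ms) (upTo (suc (maxL β))))))
    ≅ ((qpow (dinv2 k ms as) ⊗ xiCoeff k ms as β) / (polyPow oneMinusQ (length ms) ⊗ aut2 ms as))
sortedPair-contribution k k≥1 ms as β las lβ s₂ =
  ≅-trans (proper-sumR (proper-map (λ _ → proper-D) labellings)) (sumR-map-cong (All.map (λ {bs} → per-labelling bs) members))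
  (≅-trans proper-D (sumR-commonDen (λ bs → q₂ ⊗ blockSum bl (λ _ → 0) bs) proper-D labellings)
           (mk≅ (⊗-congˡ D (≈-trans (sumP-distribˡ q₂ (blockSum bl (λ _ → 0)) labellings)
                                    (⊗-congʳ q₂ (blockSum-content bl β lβ))))))
  where
  M = suc (maxL β)
  open BlockSums k k≥1 M
  bl = sorted2⇒Blocks ms as (sym las) s₂
  P = polyPow oneMinusQ (length ms)
  D = P ⊗ aut2 ms as
  q₂ = qpow (dinv2 k ms as)
  proper-D : ConstantOne D
  proper-D = constantOne-denominator (length ms) (aut2 ms as) (constantOne-aut _==P_ (zip ms as))
  wanted : List ℕ → Bool
  wanted bs = sameContent bs β ∧ sorted3 ms as bs
  labellings = filterᵇ wanted (tuples (length ms) (upTo M))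
  members : All (λ bs → (length bs ≡ length ms × All (_< M) bs) × wanted bs ≡ true) labellings
  members = All.zip (All.filter⁺ _ (tuples-All (length ms) (upTo-< M)) , All-filterᵇ wanted (tuples (length ms) (upTo M)))
  per-labelling : ∀ bs → (length bs ≡ length ms × All (_< M) bs) × wanted bs ≡ true →
    (qpow (dinv3 k ms as bs) / (P ⊗ aut3 ms as bs)) ≅ ((q₂ ⊗ blockSum bl (λ _ → 0) bs) / D)
  per-labelling bs ((lb , b<M) , ok) = mk≅ (begin
    qpow (dinv3 k ms as bs) ⊗ (P ⊗ aut2 ms as)
      ≡⟨ cong (λ d → qpow d ⊗ (P ⊗ aut2 ms as)) (dinv-split k ms as bs (sym lb) (trans las (sym lb))) ⟩
    qpow (dinv2 k ms as + invD k ms as bs) ⊗ (P ⊗ aut2 ms as)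
      ≈⟨ ⊗-congˡ (P ⊗ aut2 ms as) (qpow-+ (dinv2 k ms as) (invD k ms as bs)) ⟩
    (q₂ ⊗ qpow (invD k ms as bs)) ⊗ (P ⊗ aut2 ms as)
      ≈⟨ ⊗-interchange q₂ _ P _ ⟩
    (q₂ ⊗ P) ⊗ (qpow (invD k ms as bs) ⊗ aut2 ms as)
      ≡⟨ cong (λ d → (q₂ ⊗ P) ⊗ (qpow d ⊗ aut2 ms as)) (weightedInv-zero k ms as bs) ⟨
    (q₂ ⊗ P) ⊗ (qpow (weightedInv k (λ _ → 0) ms as bs) ⊗ aut2 ms as)
      ≈⟨ ⊗-congʳ (q₂ ⊗ P) (blockSum-aut bl (λ _ → 0) bs lb (proj₁ (sorted3⇔ ms as bs) (∧-eliminʳ (sameContent bs β) ok)) b<M) ⟨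
    (q₂ ⊗ P) ⊗ (blockSum bl (λ _ → 0) bs ⊗ aut3 ms as bs)
      ≈⟨ ⊗-interchange q₂ P _ _ ⟩
    (q₂ ⊗ blockSum bl (λ _ → 0) bs) ⊗ (P ⊗ aut3 ms as bs) ∎)
    where open ≈-Reasoning

module Coefficient (n k : ℕ) (k≥1 : 1 ≤ k) (α β : List ℕ) (lβ : length β ≡ n) where

  labels-α labels-β : List (List ℕ)
  labels-α = tuples n (upTo (suc (maxL α)))
  labels-β = tuples n (upTo (suc (maxL β)))

  lhsTerm : List ℕ → List ℕ → List ℕ → RatQ
  lhsTerm ms as bs = qpow (dinv3 k ms as bs) / (polyPow oneMinusQ n ⊗ aut3 ms as bs)

  rhsTerm : List ℕ → List ℕ → RatQ
  rhsTerm ms as = (qpow (dinv2 k ms as) ⊗ xiCoeff k ms as β) / (polyPow oneMinusQ n ⊗ aut2 ms as)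

  lhsPair : List ℕ → List ℕ → List RatQ
  lhsPair ms as = map (lhsTerm ms as) (filterᵇ (λ bs → sameContent bs β ∧ sorted3 ms as bs) labels-β)

  proper-lhsTerm : ∀ ms as bs → Proper (lhsTerm ms as bs)
  proper-lhsTerm ms as bs = constantOne-denominator n (aut3 ms as bs) (constantOne-aut _==T_ (zip3 ms as bs))

  proper-rhsTerm : ∀ ms as → Proper (rhsTerm ms as)
  proper-rhsTerm ms as = constantOne-denominator n (aut2 ms as) (constantOne-aut _==P_ (zip ms as))

  proper-lhsPair : ∀ ms as → All Proper (lhsPair ms as)
  proper-lhsPair ms as = proper-map (proper-lhsTerm ms as) (filterᵇ (λ bs → sameContent bs β ∧ sorted3 ms as bs) labels-β)

  unsorted-empty : ∀ ms as → length ms ≡ n → length as ≡ n → sorted2 ms as ≡ false → lhsPair ms as ≡ []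
  unsorted-empty ms as lms las unsorted =
    cong (map (lhsTerm ms as)) (List.filter-none _ (All.map (λ {bs} (lbs , _) → rejected bs lbs) (tuples-All n (upTo-< (suc (maxL β))))))
    where
    rejected : ∀ bs → length bs ≡ n → ¬ T (sameContent bs β ∧ sorted3 ms as bs)
    rejected bs lbs t = true≢false (trans (sym (sorted3⇒sorted2 ms as bs (trans lms (sym lbs)) (trans las (sym lbs))
                                                  (∧-eliminʳ (sameContent bs β) (T⇒≡true t)))) unsorted)

  pair-identity : ∀ ms as → length ms ≡ n → length as ≡ n →
    (if sameContent as α then sumR (lhsPair ms as) else zeroR)
      ≅ (if sameContent as α ∧ sorted2 ms as then rhsTerm ms as else zeroR)
  pair-identity ms as lms las with sameContent as α
  ... | false = ≅-refl
  ... | true with sorted2 ms as in sorted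
  ...   | true  rewrite sym lms = sortedPair-contribution k k≥1 ms as β las lβ sorted
  ...   | false rewrite unsorted-empty ms as lms las sorted = ≅-refl

  row-identity : ∀ ms → length ms ≡ n →
    sumR (concatMap (lhsPair ms) (filterᵇ (λ as → sameContent as α) labels-α))
      ≅ sumR (map (rhsTerm ms) (filterᵇ (λ as → sameContent as α ∧ sorted2 ms as) labels-α))
  row-identity ms lms =
    ≅-trans (proper-sumR (proper-map (λ as → proper-sumR (proper-lhsPair ms as)) chosen))
      (sumR-concatMap (lhsPair ms) chosen (proper-lhsPair ms))
    (≅-trans (proper-sumR (proper-map proper-if-lhs labels-α))
      (sumR-filter (λ as → sameContent as α) (λ as → sumR (lhsPair ms as)) (λ as → proper-sumR (proper-lhsPair ms as)) labels-α)
    (≅-trans (proper-sumR (proper-map proper-if-rhs labels-α))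
      (sumR-map-cong (All.map (λ {as} (las , _) → pair-identity ms as lms las) (tuples-All n (upTo-< (suc (maxL α))))))
      (≅-sym (sumR-filter (λ as → sameContent as α ∧ sorted2 ms as) (rhsTerm ms) (proper-rhsTerm ms) labels-α))))
    where
    chosen = filterᵇ (λ as → sameContent as α) labels-α
    proper-if-lhs : ∀ as → Proper (if sameContent as α then sumR (lhsPair ms as) else zeroR)
    proper-if-lhs as with sameContent as α
    ... | true  = proper-sumR (proper-lhsPair ms as)
    ... | false = refl
    proper-if-rhs : ∀ as → Proper (if sameContent as α ∧ sorted2 ms as then rhsTerm ms as else zeroR)
    proper-if-rhs as with sameContent as α ∧ sorted2 ms as
    ... | true  = proper-rhsTerm ms as
    ... | false = refl

  coefficient-identity : ∀ N → lhsCoeff n k N α β ≅ rhsCoeff n k N α β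
  coefficient-identity N =
    ≅-trans (proper-sumR (proper-map (λ ms → proper-sumR (lhsRow-proper ms)) weights))
      (sumR-concatMap lhsRow weights lhsRow-proper)
    (≅-trans (proper-sumR (proper-map (λ ms → proper-sumR (rhsRow-proper ms)) weights))
      (sumR-map-cong (All.map (λ {ms} (lms , _) → row-identity ms lms) (All.filter⁺ _ (tuples-All n (upTo-< (suc N))))))
      (≅-sym (sumR-concatMap rhsRow weights rhsRow-proper)))
    where
    weights = filterᵇ (λ ms → sum ms ≡ᵇ N) (tuples n (upTo (suc N)))
    lhsRow rhsRow : List ℕ → List RatQ
    lhsRow ms = concatMap (lhsPair ms) (filterᵇ (λ as → sameContent as α) labels-α)
    rhsRow ms = map (rhsTerm ms) (filterᵇ (λ as → sameContent as α ∧ sorted2 ms as) labels-α)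
    lhsRow-proper : ∀ ms → All Proper (lhsRow ms)
    lhsRow-proper ms = All.concat⁺ (All.map⁺ (All.universal (proper-lhsPair ms) (filterᵇ (λ as → sameContent as α) labels-α)))
    rhsRow-proper : ∀ ms → All Proper (rhsRow ms)
    rhsRow-proper ms = proper-map (proper-rhsTerm ms) (filterᵇ (λ as → sameContent as α ∧ sorted2 ms as) labels-α)

proposition4p2 : (n k : ℕ) → 1 ≤ n → 1 ≤ k →
    (N : ℕ) (α β : List ℕ) → length α ≡ n → length β ≡ n →
    All (1 ≤_) α → All (1 ≤_) β →
    lhsCoeff n k N α β ≃ rhsCoeff n k N α β
proposition4p2 n k _ k≥1 N α β _ lβ _ _ = coeff-≡ (cross-≈ (coefficient-identity N))
  where open Coefficient n k k≥1 α β lβ
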